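{- Let $\Delta>0$ be an integer and let $(\dot P_0,\dot T_0),\dots,(\dot P_{z-1},\dot T_{z-1})$, $z\ge2$, be pairs of strings of lengths at least $\Delta$ such that for every $s\in[0,z-1)$, $\dot P_s[|\dot P_s|-\Delta..|\dot P_s|)=\dot P_{s+1}[0..\Delta)$ and $\dot T_s[|\dot T_s|-\Delta..|\dot T_s|)=\dot T_{s+1}[0..\Delta)$. Let $P=\dot P_0\odot_\Delta\cdots\odot_\Delta\dot P_{z-1}$ and $T=\dot T_0\odot_\Delta\cdots\odot_\Delta\dot T_{z-1}$, and let $\tau=\sum_{s=0}^{z-1}\big||\dot T_s|-|\dot P_s|\big|$. Then for every integer $k\le\lfloor\Delta/2\rfloor-\tau$, $$D_\Delta(P,T)\ \equiv_k\ D^{\mathrm{lead}}_\Delta(\dot P_0,\dot T_0)\oplus\Big(\bigoplus_{s=1}^{z-2}D^{\mathrm{int}}_\Delta(\dot P_s,\dot T_s)\Big)\oplus D^{\mathrm{trail}}_\Delta(\dot P_{z-1},\dot T_{z-1}).$$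
   Context: $w:\bar\Sigma^2\to[0,W]$ is a normalized weight function ($\bar\Sigma=\Sigma\cup\{\varepsilon\}$, $w(a,a)=0$, $w(a,b)\ge1$ for $a\ne b$). The augmented alignment graph $\overline{\mathsf{AG}}^w(X,Y)$ has vertices $\{0..|X|\}\times\{0..|Y|\}$, edges $(x,y)\to(x+1,y)$ of cost $w(X[x],\varepsilon)$, $(x,y)\to(x,y+1)$ of cost $w(\varepsilon,Y[y])$, $(x,y)\to(x+1,y+1)$ of cost $w(X[x],Y[y])$, and for each such edge a reverse edge of cost $W+1$. For strings $X,Y$ with $\Delta\le|Y|$, $D_\Delta(X,Y)$ is the $(\Delta+1)\times(\Delta+1)$ matrix with $D_\Delta(X,Y)[i,j]=\mathrm{dist}_{\overline{\mathsf{AG}}^w(X,Y)}((0,i),(|X|,|Y|-\Delta+j))$. Further $D^{\mathrm{int}}_\Delta(X,Y)=D_\Delta(X[\lfloor\Delta/2\rfloor..|X|-\lceil\Delta/2\rceil),Y)$, $D^{\mathrm{lead}}_\Delta(X,Y)=D_\Delta(X[0..|X|-\lceil\Delta/2\rceil),Y)$, $D^{\mathrm{trail}}_\Delta(X,Y)=D_\Delta(X[\lfloor\Delta/2\rfloor..|X|),Y)$. For strings $S,S'$ with $S[|S|-\Delta..|S|)=S'[0..\Delta)$, $S\odot_\Delta S'=S\cdot S'[\Delta..|S'|)$. $\oplus$ is the $(\min,+)$ matrix product $(A\oplus B)[i,j]=\min_\ell(A[i,\ell]+B[\ell,j])$. Reals $a,b$ are $k$-equivalent ($a\equiv_k b$)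 if $a=b$ or $k\le\min\{a,b\}$; matrices are $k$-equivalent if entrywise so.
   Formalization: The normalized weight function w and its bound W take rational values instead of real ones. -}

module Defs where

open import Data.Nat as ℕ using (ℕ; zero; suc; _∸_; ∣_-_∣)
open import Data.Integer as ℤ using (ℤ; +_)
open import Data.Rational as ℚ using (ℚ; 0ℚ; 1ℚ; _⊓_)
open import Data.Fin using (Fin; toℕ) renaming (zero to fzero; suc to fsuc)
open import Data.List using (List; []; _∷_; length; lookup; take; drop; _++_)
open import Data.Maybe using (Maybe; just; nothing)
open import Data.Product using (Σ; _×_; _,_)
open import Data.Sum using (_⊎_)
open import Relation.Binary.PropositionalEquality using (_≡_; _≢_)

-- Normalized weight functions  w : Σ̄² → [0,W],  Σ̄ = Σ ∪ {ε}
-- (ε is represented by `nothing`).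

record NormalizedWeight (A : Set) : Set where
  field
    W      : ℚ
    w      : Maybe A → Maybe A → ℚ
    w-≥0   : ∀ a b → 0ℚ ℚ.≤ w a b
    w-≤W   : ∀ a b → w a b ℚ.≤ W
    w-refl : ∀ a → w a a ≡ 0ℚ
    w-≥1   : ∀ a b → a ≢ b → 1ℚ ℚ.≤ w a b

module _ {A : Set} (ω : NormalizedWeight A) (X Y : List A) where
  open NormalizedWeight ω

  Vertex : Set
  Vertex = ℕ × ℕ

  data Edge : Vertex → Vertex → Set where
    del : (x : Fin (length X)) (y : ℕ) → y ℕ.≤ length Y →
          Edge (toℕ x , y) (suc (toℕ x) , y)
    ins : (x : ℕ) (y : Fin (length Y)) → x ℕ.≤ length X →
          Edge (x , toℕ y) (x , suc (toℕ y))
    sub : (x : Fin (length X)) (y : Fin (length Y)) →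
          Edge (toℕ x , toℕ y) (suc (toℕ x) , suc (toℕ y))

  edgeCost : ∀ {u v} → Edge u v → ℚ
  edgeCost (del x y _) = w (just (lookup X x)) nothing
  edgeCost (ins x y _) = w nothing (just (lookup Y y))
  edgeCost (sub x y)   = w (just (lookup X x)) (just (lookup Y y))

  data Step : Vertex → Vertex → Set where
    fwd : ∀ {u v} → Edge u v → Step u v
    bwd : ∀ {u v} → Edge u v → Step v u

  stepCost : ∀ {u v} → Step u v → ℚ
  stepCost (fwd e) = edgeCost e
  stepCost (bwd e) = W ℚ.+ 1ℚ

  data Walk : Vertex → Vertex → Set where
    []  : ∀ {u} → Walk u u
    _∷_ : ∀ {u v t} → Step u v → Walk v t → Walk u t

  walkCost : ∀ {u v} → Walk u v → ℚ
  walkCost []       = 0ℚ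
  walkCost (s ∷ ws) = stepCost s ℚ.+ walkCost ws

  IsDist : Vertex → Vertex → ℚ → Set
  IsDist u v d = (Σ (Walk u v) λ p → walkCost p ≡ d)
               × (∀ (p : Walk u v) → d ℚ.≤ walkCost p)

Matrix : ℕ → Set
Matrix Δ = Fin (suc Δ) → Fin (suc Δ) → ℚ

minFin : ∀ {n} → (Fin (suc n) → ℚ) → ℚ
minFin {zero}  f = f fzero
minFin {suc n} f = f fzero ⊓ minFin (λ i → f (fsuc i))

_⊕_ : ∀ {Δ} → Matrix Δ → Matrix Δ → Matrix Δ
(M ⊕ N) i j = minFin (λ l → M i l ℚ.+ N l j)

infixr 6 _⊕_

-- M is the matrix D_Δ(X,Y)  (requires Δ ≤ |Y|):
-- M[i,j] = dist((0,i), (|X|, |Y|-Δ+j))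
IsD : ∀ {A : Set} → NormalizedWeight A → (Δ : ℕ) → List A → List A → Matrix Δ → Set
IsD ω Δ X Y M = ∀ i j →
  IsDist ω X Y (0 , toℕ i) (length X , (length Y ∸ Δ) ℕ.+ toℕ j) (M i j)

ceilHalf : ℕ → ℕ
ceilHalf Δ = Δ ∸ (Δ ℕ./ 2)

Xint Xlead Xtrail : ∀ {A : Set} → ℕ → List A → List A
Xint   Δ X = drop (Δ ℕ./ 2) (take (length X ∸ ceilHalf Δ) X)
Xlead  Δ X = take (length X ∸ ceilHalf Δ) X
Xtrail Δ X = drop (Δ ℕ./ 2) X

IsDint IsDlead IsDtrail :
  ∀ {A : Set} → NormalizedWeight A → (Δ : ℕ) → List A → List A → Matrix Δ → Set
IsDint   ω Δ X Y M = IsD ω Δ (Xint   Δ X) Y M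
IsDlead  ω Δ X Y M = IsD ω Δ (Xlead  Δ X) Y M
IsDtrail ω Δ X Y M = IsD ω Δ (Xtrail Δ X) Y M

odot : ∀ {A : Set} → ℕ → List A → List A → List A
odot Δ S S' = S ++ drop Δ S'

glue : ∀ {A : Set} → ℕ → (ℕ → List A) → ℕ → List A
glue Δ f zero    = f 0
glue Δ f (suc n) = odot Δ (glue Δ f n) (f (suc n))

sumTo : ℕ → (ℕ → ℕ) → ℕ
sumTo zero    f = 0
sumTo (suc n) f = sumTo n f ℕ.+ f n

chain : ∀ {Δ} → Matrix Δ → (ℕ → Matrix Δ) → ℕ → ℕ → Matrix Δ → Matrix Δ
chain L M s zero    R = L ⊕ R
chain L M s (suc n) R = L ⊕ chain (M s) M (suc s) n R

_≡[_]_ : ℚ → ℚ → ℚ → Set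
a ≡[ k ] b = (a ≡ b) ⊎ (k ℚ.≤ a × k ℚ.≤ b)

_≡M[_]_ : ∀ {Δ} → Matrix Δ → ℚ → Matrix Δ → Set
M ≡M[ k ] N = ∀ i j → M i j ≡[ k ] N i j

ℤtoℚ : ℤ → ℚ
ℤtoℚ k = k ℚ./ 1

{-# OPTIONS --safe #-}
module Submission where

-- Both sides are costs of paths in alignment graphs. Embedding optimal paths of the pieces at their
-- offsets in P and T and concatenating them realises every entry of the ⊕-product by a path in
-- AG̅(P,T), so D is at most the product. Conversely, take an optimal path for an entry of D of cost
-- below k and cut it where it first reaches each row at which a piece starts (the middle of an
-- overlap). A part that later climbs back above such a row can be replaced by a run along that row,
-- since insertions cost at most W and backward edges W + 1; so the path becomes a concatenation of
-- layers without getting costlier. A path with n indels costs at least n and stays within n of the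
-- diagonals through its end points, while the offsets of the pieces in P and in T differ by at most
-- τ; as τ + n < ⌊Δ/2⌋, each layer stays inside the subgraph of its piece, whose distance matrix
-- therefore bounds the layer from below. If instead the entry of D is at least k, so is the product.

open import Defs
open import Data.Nat as ℕ using (ℕ; zero; suc; _∸_; ∣_-_∣; z≤n; s≤s)
import Data.Nat.Properties as ℕP
import Data.Nat.DivMod as ℕDM
open import Data.Nat.Tactic.RingSolver using (solve-∀)
open import Data.Nat.Coprimality using (Coprime; 1-coprimeTo) renaming (sym to coprime-sym)
open import Data.Integer as ℤ using (ℤ; +_)
import Data.Integer.Properties as ℤP
import Data.Integer.Tactic.RingSolver as ℤSolver
open import Data.Rational as ℚ using (ℚ; 0ℚ; 1ℚ; mkℚ)
import Data.Rational.Properties as ℚP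
open import Algebra.Definitions.RawMonoid ℚ.+-0-rawMonoid using () renaming (_×_ to _·_)
open import Data.List using (List; length; take; drop; _++_) renaming ([] to []ₗ; _∷_ to _∷ₗ_; lookup to lookupₗ)
import Data.List.Properties as ListP
open import Data.Maybe using (Maybe; just; nothing)
open import Data.Fin using (Fin; toℕ; fromℕ<) renaming (zero to fzero; suc to fsuc)
import Data.Fin.Properties as FinP
open import Data.Product using (Σ; _×_; _,_; proj₁; proj₂)
open import Data.Sum using (inj₁; inj₂)
open import Data.Empty using (⊥-elim)
open import Relation.Binary.PropositionalEquality
open import Relation.Nullary using (yes; no)

p≤q⇒p≤r+q : ∀ {p q r} → 0ℚ ℚ.≤ r → p ℚ.≤ q → p ℚ.≤ r ℚ.+ q
p≤q⇒p≤r+q {p} 0≤r p≤q = ℚP.≤-trans (ℚP.≤-reflexive (sym (ℚP.+-identityˡ p))) (ℚP.+-mono-≤ 0≤r p≤q)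

p≤q⇒p≤q+r : ∀ {p q r} → 0ℚ ℚ.≤ r → p ℚ.≤ q → p ℚ.≤ q ℚ.+ r
p≤q⇒p≤q+r {p} 0≤r p≤q = ℚP.≤-trans (ℚP.≤-reflexive (sym (ℚP.+-identityʳ p))) (ℚP.+-mono-≤ p≤q 0≤r)

0≤1 : 0ℚ ℚ.≤ 1ℚ
0≤1 = ℚP.nonNegative⁻¹ 1ℚ

sumTo-mono : ∀ f {m n} → m ℕ.≤ n → sumTo m f ℕ.≤ sumTo n f
sumTo-mono f {n = zero}  z≤n = ℕP.≤-refl
sumTo-mono f {n = suc n} m≤ with ℕP.m≤n⇒m<n∨m≡n m≤
... | inj₁ m<1+n = ℕP.≤-trans (sumTo-mono f (ℕP.≤-pred m<1+n)) (ℕP.m≤m+n _ _)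
... | inj₂ refl  = ℕP.≤-refl

-- Termwise f ≤ g + h, summed over [m, n) and written without subtraction.
sumTo-skew : ∀ (f g h : ℕ → ℕ) {m n} → m ℕ.≤ n → (∀ s → s ℕ.< n → f s ℕ.≤ g s ℕ.+ h s) →
             sumTo n f ℕ.+ sumTo m g ℕ.≤ sumTo n g ℕ.+ sumTo m f ℕ.+ sumTo n h
sumTo-skew f g h {n = zero}  z≤n _ = ℕP.≤-refl
sumTo-skew f g h {m} {suc n} m≤ f≤g+h with ℕP.m≤n⇒m<n∨m≡n m≤
... | inj₂ refl  = ℕP.≤-trans (ℕP.≤-reflexive (ℕP.+-comm (sumTo m f) _)) (ℕP.m≤m+n _ _)
... | inj₁ m<1+n = begin
  sumTo n f ℕ.+ f n ℕ.+ sumTo m g                          ≡⟨ regroup₁ (sumTo n f) (f n) (sumTo m g) ⟩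
  sumTo n f ℕ.+ sumTo m g ℕ.+ f n                          ≤⟨ ℕP.+-mono-≤ (sumTo-skew f g h (ℕP.≤-pred m<1+n) (λ s s<n → f≤g+h s (ℕP.m<n⇒m<1+n s<n)))
                                                                         (f≤g+h n ℕP.≤-refl) ⟩
  sumTo n g ℕ.+ sumTo m f ℕ.+ sumTo n h ℕ.+ (g n ℕ.+ h n)  ≡⟨ regroup₂ (sumTo n g) (sumTo m f) (sumTo n h) (g n) (h n) ⟩
  sumTo n g ℕ.+ g n ℕ.+ sumTo m f ℕ.+ (sumTo n h ℕ.+ h n)  ∎
  where
  open ℕP.≤-Reasoning
  regroup₁ : ∀ a b c → a ℕ.+ b ℕ.+ c ≡ a ℕ.+ c ℕ.+ b
  regroup₁ = solve-∀
  regroup₂ : ∀ a b c d e → a ℕ.+ b ℕ.+ c ℕ.+ (d ℕ.+ e) ≡ a ℕ.+ d ℕ.+ b ℕ.+ (c ℕ.+ e)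
  regroup₂ = solve-∀

half+half≤ : ∀ Δ → Δ ℕ./ 2 ℕ.+ Δ ℕ./ 2 ℕ.≤ Δ
half+half≤ Δ = ℕP.≤-trans (ℕP.≤-reflexive (double (Δ ℕ./ 2))) (ℕDM.m/n*n≤m Δ 2)
  where
  double : ∀ h → h ℕ.+ h ≡ h ℕ.* 2
  double = solve-∀

private
  coprime-1 : ∀ n → Coprime n 1
  coprime-1 n = coprime-sym (1-coprimeTo n)

  ·1ℚ≡ : ∀ n → n · 1ℚ ≡ mkℚ (+ n) 0 (coprime-1 n)
  ·1ℚ≡ zero    = refl
  ·1ℚ≡ (suc n) = trans (cong (1ℚ ℚ.+_) (·1ℚ≡ n))
                   (trans (cong (ℚ._/ 1) (cong (ℤ._+_ (+ 1)) (ℤP.*-identityʳ (+ n))))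
                          (ℚP.↥p/↧p≡p (mkℚ (+ suc n) 0 (coprime-1 (suc n)))))

  ℤtoℚ≡ : ∀ k → ℤtoℚ k ≡ mkℚ k 0 (coprime-1 ℤ.∣ k ∣)
  ℤtoℚ≡ k = ℚP.↥p/↧p≡p (mkℚ k 0 (coprime-1 ℤ.∣ k ∣))

·1ℚ<ℤtoℚ⇒< : ∀ n k → n · 1ℚ ℚ.< ℤtoℚ k → + n ℤ.< k
·1ℚ<ℤtoℚ⇒< n k n<k = subst₂ ℤ._<_ (ℤP.*-identityʳ (+ n)) (ℤP.*-identityʳ k)
                       (ℚP.drop-*<* (subst₂ ℚ._<_ (·1ℚ≡ n) (ℤtoℚ≡ k) n<k))

+N<k≤f-τ⇒τ+N<f : ∀ {N τ f k} → + N ℤ.< k → k ℤ.≤ + f ℤ.- + τ → τ ℕ.+ N ℕ.< f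
+N<k≤f-τ⇒τ+N<f {N} {τ} {f} N<k k≤f-τ =
  ℤP.drop‿+<+ (ℤP.<-≤-trans (ℤP.+-monoʳ-< (+ τ) N<k)
                (ℤP.≤-trans (ℤP.+-monoʳ-≤ (+ τ) k≤f-τ) (ℤP.≤-reflexive (cancel (+ f) (+ τ)))))
  where
  cancel : ∀ a b → b ℤ.+ (a ℤ.- b) ≡ a
  cancel = ℤSolver.solve-∀

≡[]-intro : ∀ {a b k} → a ℚ.≤ b → (a ℚ.< k → b ℚ.≤ a) → a ≡[ k ] b
≡[]-intro {a} {b} {k} a≤b a<k⇒b≤a with a ℚ.<? k
... | yes a<k = inj₁ (ℚP.≤-antisym a≤b (a<k⇒b≤a a<k))
... | no  a≮k = inj₂ (ℚP.≮⇒≥ a≮k , ℚP.≤-trans (ℚP.≮⇒≥ a≮k) a≤b)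

minFin-≤ : ∀ {n} (f : Fin (suc n) → ℚ) i → minFin f ℚ.≤ f i
minFin-≤ {zero}  f fzero    = ℚP.≤-refl
minFin-≤ {suc n} f fzero    = ℚP.p⊓q≤p (f fzero) _
minFin-≤ {suc n} f (fsuc i) = ℚP.≤-trans (ℚP.p⊓q≤q (f fzero) _) (minFin-≤ (λ i → f (fsuc i)) i)

minFin-attained : ∀ {n} (f : Fin (suc n) → ℚ) → Σ (Fin (suc n)) λ i → minFin f ≡ f i
minFin-attained {zero}  f = fzero , refl
minFin-attained {suc n} f with ℚP.⊓-sel (f fzero) (minFin (λ i → f (fsuc i)))
... | inj₁ e = fzero , e
... | inj₂ e with minFin-attained (λ i → f (fsuc i))
...   | i , e′ = fsuc i , trans e e′

⊕-≤ : ∀ {Δ} (L R : Matrix Δ) l l′ j {a b} → L l l′ ℚ.≤ a → R l′ j ℚ.≤ b → (L ⊕ R) l j ℚ.≤ a ℚ.+ b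
⊕-≤ L R l l′ j L≤a R≤b = ℚP.≤-trans (minFin-≤ (λ k → L l k ℚ.+ R k j) l′) (ℚP.+-mono-≤ L≤a R≤b)

⊕-attained : ∀ {Δ} (L R : Matrix Δ) l j → Σ (Fin (suc Δ)) λ l′ → (L ⊕ R) l j ≡ L l l′ ℚ.+ R l′ j
⊕-attained L R l j = minFin-attained (λ k → L l k ℚ.+ R k j)

-- Paths in the alignment graph

Point : Set
Point = ℕ × ℕ

row col : Point → ℕ
row = proj₁
col = proj₂

module _ {A : Set} where

  at : List A → ℕ → Maybe A
  at []ₗ       _       = nothing
  at (a ∷ₗ as) zero    = just a
  at (a ∷ₗ as) (suc n) = at as n

  at-lookup : ∀ (X : List A) i → at X (toℕ i) ≡ just (lookupₗ X i)
  at-lookup (a ∷ₗ as) fzero    = refl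
  at-lookup (a ∷ₗ as) (fsuc i) = at-lookup as i

  at-inRange : ∀ (X : List A) {n} → n ℕ.< length X → at X n ≢ nothing
  at-inRange (a ∷ₗ as) {zero}  _       ()
  at-inRange (a ∷ₗ as) {suc n} (s≤s p) = at-inRange as p

module AlignmentPaths {A : Set} (ω : NormalizedWeight A) (X Y : List A) where
  open NormalizedWeight ω

  delCost insCost : ℕ → ℚ
  delCost x = w (at X x) nothing
  insCost y = w nothing (at Y y)

  subCost : ℕ → ℕ → ℚ
  subCost x y = w (at X x) (at Y y)

  backCost : ℚ
  backCost = W ℚ.+ 1ℚ

  -- The steps of AG̅^w(X,Y), indexed by plain coordinates instead of Fin.
  data Move : Point → Point → ℚ → Set where
    del  : ∀ x y → x ℕ.< length X → y ℕ.≤ length Y → Move (x , y) (suc x , y) (delCost x)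
    ins  : ∀ x y → x ℕ.≤ length X → y ℕ.< length Y → Move (x , y) (x , suc y) (insCost y)
    sub  : ∀ x y → x ℕ.< length X → y ℕ.< length Y → Move (x , y) (suc x , suc y) (subCost x y)
    del⁻ : ∀ x y → x ℕ.< length X → y ℕ.≤ length Y → Move (suc x , y) (x , y) backCost
    ins⁻ : ∀ x y → x ℕ.≤ length X → y ℕ.< length Y → Move (x , suc y) (x , y) backCost
    sub⁻ : ∀ x y → x ℕ.< length X → y ℕ.< length Y → Move (suc x , suc y) (x , y) backCost

  infixr 5 _∷_ _++ₚ_

  data Path : Point → Point → Set where
    []  : ∀ {u} → Path u u
    _∷_ : ∀ {u v t c} → Move u v c → Path v t → Path u t

  cost : ∀ {u v} → Path u v → ℚ
  cost []                  = 0ℚ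
  cost (_∷_ {c = c} _ q) = c ℚ.+ cost q

  _++ₚ_ : ∀ {u v t} → Path u v → Path v t → Path u t
  []      ++ₚ q = q
  (m ∷ p) ++ₚ q = m ∷ (p ++ₚ q)

  cost-++ : ∀ {u v t} (p : Path u v) (q : Path v t) → cost (p ++ₚ q) ≡ cost p ℚ.+ cost q
  cost-++ []                  q = sym (ℚP.+-identityˡ _)
  cost-++ (_∷_ {c = c} _ p) q = trans (cong (c ℚ.+_) (cost-++ p q)) (sym (ℚP.+-assoc c (cost p) (cost q)))

  All : (Point → Set) → ∀ {u v} → Path u v → Set
  All P {u} []      = P u
  All P {u} (_ ∷ q) = P u × All P q

  module _ {P : Point → Set} where

    All-head : ∀ {u v} (q : Path u v) → All P q → P u
    All-head []      pu       = pu
    All-head (_ ∷ _) (pu , _) = pu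

    All-last : ∀ {u v} (q : Path u v) → All P q → P v
    All-last []      pv       = pv
    All-last (_ ∷ q) (_ , pq) = All-last q pq

    All-++ : ∀ {u v t} (p : Path u v) (q : Path v t) → All P p → All P q → All P (p ++ₚ q)
    All-++ []      q _         pq = pq
    All-++ (_ ∷ p) q (pu , pp) pq = pu , All-++ p q pp pq

    All-++⁻ˡ : ∀ {u v t} (p : Path u v) (q : Path v t) → All P (p ++ₚ q) → All P p
    All-++⁻ˡ []      q pq        = All-head q pq
    All-++⁻ˡ (_ ∷ p) q (pu , pp) = pu , All-++⁻ˡ p q pp

    All-++⁻ʳ : ∀ {u v t} (p : Path u v) (q : Path v t) → All P (p ++ₚ q) → All P q
    All-++⁻ʳ []      q pq       = pq
    All-++⁻ʳ (_ ∷ p) q (_ , pp) = All-++⁻ʳ p q pp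

    All-universal : (∀ x → P x) → ∀ {u v} (q : Path u v) → All P q
    All-universal p {u} []      = p u
    All-universal p {u} (_ ∷ q) = p u , All-universal p q

    All-map : ∀ {Q : Point → Set} → (∀ x → P x → Q x) → ∀ {u v} (q : Path u v) → All P q → All Q q
    All-map f {u} []      pu        = f u pu
    All-map f {u} (_ ∷ q) (pu , pq) = f u pu , All-map f q pq

  All-zip : ∀ {P Q : Point → Set} {u v} (q : Path u v) → All P q → All Q q → All (λ x → P x × Q x) q
  All-zip []      pu        qu        = pu , qu
  All-zip (_ ∷ q) (pu , pq) (qu , qq) = (pu , qu) , All-zip q pq qq

  fromStep : ∀ {u v} (s : Step ω X Y u v) → Move u v (stepCost ω X Y s)
  fromStep (fwd (del x y p)) = subst (Move _ _) (cong (λ a → w a nothing) (at-lookup X x))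
                                 (del (toℕ x) y (FinP.toℕ<n x) p)
  fromStep (fwd (ins x y p)) = subst (Move _ _) (cong (w nothing) (at-lookup Y y))
                                 (ins x (toℕ y) p (FinP.toℕ<n y))
  fromStep (fwd (sub x y))   = subst (Move _ _) (cong₂ w (at-lookup X x) (at-lookup Y y))
                                 (sub (toℕ x) (toℕ y) (FinP.toℕ<n x) (FinP.toℕ<n y))
  fromStep (bwd (del x y p)) = del⁻ (toℕ x) y (FinP.toℕ<n x) p
  fromStep (bwd (ins x y p)) = ins⁻ x (toℕ y) p (FinP.toℕ<n y)
  fromStep (bwd (sub x y))   = sub⁻ (toℕ x) (toℕ y) (FinP.toℕ<n x) (FinP.toℕ<n y)

  private
    asFin : ∀ {n} x → x ℕ.< n → Σ (Fin n) λ i → toℕ i ≡ x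
    asFin x p = fromℕ< p , FinP.toℕ-fromℕ< p

  toStep : ∀ {u v c} → Move u v c → Σ (Step ω X Y u v) λ s → stepCost ω X Y s ≡ c
  toStep (del x y p q) with asFin x p
  ... | i , refl = fwd (del i y q) , cong (λ a → w a nothing) (sym (at-lookup X i))
  toStep (ins x y p q) with asFin y q
  ... | j , refl = fwd (ins x j p) , cong (w nothing) (sym (at-lookup Y j))
  toStep (sub x y p q) with asFin x p | asFin y q
  ... | i , refl | j , refl = fwd (sub i j) , cong₂ w (sym (at-lookup X i)) (sym (at-lookup Y j))
  toStep (del⁻ x y p q) with asFin x p
  ... | i , refl = bwd (del i y q) , refl
  toStep (ins⁻ x y p q) with asFin y q
  ... | j , refl = bwd (ins x j p) , refl
  toStep (sub⁻ x y p q) with asFin x p | asFin y q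
  ... | i , refl | j , refl = bwd (sub i j) , refl

  fromWalk : ∀ {u v} (p : Walk ω X Y u v) → Σ (Path u v) λ q → cost q ≡ walkCost ω X Y p
  fromWalk []      = [] , refl
  fromWalk (s ∷ p) with fromWalk p
  ... | q , e = fromStep s ∷ q , cong (stepCost ω X Y s ℚ.+_) e

  toWalk : ∀ {u v} (q : Path u v) → Σ (Walk ω X Y u v) λ p → walkCost ω X Y p ≡ cost q
  toWalk []      = [] , refl
  toWalk (m ∷ q) with toStep m | toWalk q
  ... | s , e | p , e′ = s ∷ p , cong₂ ℚ._+_ e e′

  dist-realised : ∀ {u v d} → IsDist ω X Y u v d → Σ (Path u v) λ q → cost q ≡ d
  dist-realised ((p , e) , _) with fromWalk p
  ... | q , e′ = q , trans e′ e

  dist-minimal : ∀ {u v d} → IsDist ω X Y u v d → (q : Path u v) → d ℚ.≤ cost q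
  dist-minimal (_ , minimal) q with toWalk q
  ... | p , e = ℚP.≤-trans (minimal p) (ℚP.≤-reflexive e)

  0≤W : 0ℚ ℚ.≤ W
  0≤W = ℚP.≤-trans (w-≥0 nothing nothing) (w-≤W nothing nothing)

  W≤backCost : W ℚ.≤ backCost
  W≤backCost = p≤q⇒p≤q+r 0≤1 ℚP.≤-refl

  1≤backCost : 1ℚ ℚ.≤ backCost
  1≤backCost = p≤q⇒p≤r+q 0≤W ℚP.≤-refl

  0≤backCost : 0ℚ ℚ.≤ backCost
  0≤backCost = ℚP.≤-trans 0≤W W≤backCost

  move-cost≥0 : ∀ {u v c} → Move u v c → 0ℚ ℚ.≤ c
  move-cost≥0 (del _ _ _ _)  = w-≥0 _ _
  move-cost≥0 (ins _ _ _ _)  = w-≥0 _ _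
  move-cost≥0 (sub _ _ _ _)  = w-≥0 _ _
  move-cost≥0 (del⁻ _ _ _ _) = 0≤backCost
  move-cost≥0 (ins⁻ _ _ _ _) = 0≤backCost
  move-cost≥0 (sub⁻ _ _ _ _) = 0≤backCost

  cost≥0 : ∀ {u v} (q : Path u v) → 0ℚ ℚ.≤ cost q
  cost≥0 []      = ℚP.≤-refl
  cost≥0 (m ∷ q) = p≤q⇒p≤r+q (move-cost≥0 m) (cost≥0 q)

  InGrid : Point → Set
  InGrid (x , y) = x ℕ.≤ length X × y ℕ.≤ length Y

  move-target-inGrid : ∀ {u v c} → Move u v c → InGrid v
  move-target-inGrid (del _ _ p q)  = p , q
  move-target-inGrid (ins _ _ p q)  = p , q
  move-target-inGrid (sub _ _ p q)  = p , q
  move-target-inGrid (del⁻ _ _ p q) = ℕP.<⇒≤ p , q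
  move-target-inGrid (ins⁻ _ _ p q) = p , ℕP.<⇒≤ q
  move-target-inGrid (sub⁻ _ _ p q) = ℕP.<⇒≤ p , ℕP.<⇒≤ q

  path-inGrid : ∀ {u v} → InGrid u → (q : Path u v) → All InGrid q
  path-inGrid gu []      = gu
  path-inGrid gu (m ∷ q) = gu , path-inGrid (move-target-inGrid m) q

  move-source≤1+target : ∀ {u v c} → Move u v c → row u ℕ.≤ suc (row v)
  move-source≤1+target (del _ _ _ _)  = ℕP.m≤n⇒m≤1+n (ℕP.n≤1+n _)
  move-source≤1+target (ins _ _ _ _)  = ℕP.n≤1+n _
  move-source≤1+target (sub _ _ _ _)  = ℕP.m≤n⇒m≤1+n (ℕP.n≤1+n _)
  move-source≤1+target (del⁻ _ _ _ _) = ℕP.≤-refl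
  move-source≤1+target (ins⁻ _ _ _ _) = ℕP.n≤1+n _
  move-source≤1+target (sub⁻ _ _ _ _) = ℕP.≤-refl

  move-target≤1+source : ∀ {u v c} → Move u v c → row v ℕ.≤ suc (row u)
  move-target≤1+source (del _ _ _ _)  = ℕP.≤-refl
  move-target≤1+source (ins _ _ _ _)  = ℕP.n≤1+n _
  move-target≤1+source (sub _ _ _ _)  = ℕP.≤-refl
  move-target≤1+source (del⁻ _ _ _ _) = ℕP.m≤n⇒m≤1+n (ℕP.n≤1+n _)
  move-target≤1+source (ins⁻ _ _ _ _) = ℕP.n≤1+n _
  move-target≤1+source (sub⁻ _ _ _ _) = ℕP.m≤n⇒m≤1+n (ℕP.n≤1+n _)

  indelCount : ∀ {u v c} → Move u v c → ℕ
  indelCount (sub _ _ _ _)  = 0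
  indelCount (sub⁻ _ _ _ _) = 0
  indelCount _              = 1

  indels : ∀ {u v} → Path u v → ℕ
  indels []      = 0
  indels (m ∷ q) = indelCount m ℕ.+ indels q

  indels≤cost : ∀ {u v} (q : Path u v) → indels q · 1ℚ ℚ.≤ cost q
  indels≤cost []                 = ℚP.≤-refl
  indels≤cost (del x y p _ ∷ q)  = ℚP.+-mono-≤ (w-≥1 _ _ (at-inRange X p)) (indels≤cost q)
  indels≤cost (ins x y _ p ∷ q)  = ℚP.+-mono-≤ (w-≥1 _ _ (λ e → at-inRange Y p (sym e))) (indels≤cost q)
  indels≤cost (sub x y _ _ ∷ q)  = p≤q⇒p≤r+q (w-≥0 _ _) (indels≤cost q)
  indels≤cost (del⁻ x y _ _ ∷ q) = ℚP.+-mono-≤ 1≤backCost (indels≤cost q)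
  indels≤cost (ins⁻ x y _ _ ∷ q) = ℚP.+-mono-≤ 1≤backCost (indels≤cost q)
  indels≤cost (sub⁻ x y _ _ ∷ q) = p≤q⇒p≤r+q 0≤backCost (indels≤cost q)

  record Drift (u v : Point) (n : ℕ) : Set where
    constructor drift
    field
      drift≤ : row v ℕ.+ col u ℕ.≤ n ℕ.+ (row u ℕ.+ col v)

  drift-refl : ∀ u → Drift u u 0
  drift-refl _ = drift ℕP.≤-refl

  drift-mono : ∀ {u v m n} → m ℕ.≤ n → Drift u v m → Drift u v n
  drift-mono m≤n (drift d) = drift (ℕP.≤-trans d (ℕP.+-monoˡ-≤ _ m≤n))

  drift-trans : ∀ {u v t m n} → Drift u v m → Drift v t n → Drift u t (m ℕ.+ n)
  drift-trans {x₁ , y₁} {x₂ , y₂} {x₃ , y₃} {m} {n} (drift d₁) (drift d₂) =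
    drift (ℕP.+-cancelʳ-≤ (x₂ ℕ.+ y₂) _ _ (begin
      x₃ ℕ.+ y₁ ℕ.+ (x₂ ℕ.+ y₂)                 ≡⟨ regroup₁ x₁ y₁ x₂ y₂ x₃ y₃ ⟩
      (x₂ ℕ.+ y₁) ℕ.+ (x₃ ℕ.+ y₂)               ≤⟨ ℕP.+-mono-≤ d₁ d₂ ⟩
      m ℕ.+ (x₁ ℕ.+ y₂) ℕ.+ (n ℕ.+ (x₂ ℕ.+ y₃)) ≡⟨ regroup₂ m n x₁ y₁ x₂ y₂ x₃ y₃ ⟩
      m ℕ.+ n ℕ.+ (x₁ ℕ.+ y₃) ℕ.+ (x₂ ℕ.+ y₂)   ∎))
    where
    open ℕP.≤-Reasoning
    regroup₁ : ∀ x₁ y₁ x₂ y₂ x₃ y₃ → x₃ ℕ.+ y₁ ℕ.+ (x₂ ℕ.+ y₂) ≡ (x₂ ℕ.+ y₁) ℕ.+ (x₃ ℕ.+ y₂)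
    regroup₁ = solve-∀
    regroup₂ : ∀ m n x₁ y₁ x₂ y₂ x₃ y₃ →
      m ℕ.+ (x₁ ℕ.+ y₂) ℕ.+ (n ℕ.+ (x₂ ℕ.+ y₃)) ≡ m ℕ.+ n ℕ.+ (x₁ ℕ.+ y₃) ℕ.+ (x₂ ℕ.+ y₂)
    regroup₂ = solve-∀

  drift-from-left : ∀ {x y y′ v n} → y′ ℕ.≤ y → Drift (x , y) v n → Drift (x , y′) v n
  drift-from-left {v = v} y′≤y (drift d) = drift (ℕP.≤-trans (ℕP.+-monoʳ-≤ (row v) y′≤y) d)

  drift-to-right : ∀ {u x y y′ n} → y ℕ.≤ y′ → Drift u (x , y) n → Drift u (x , y′) n
  drift-to-right {u} {n = n} y≤y′ (drift d) = drift (ℕP.≤-trans d (ℕP.+-monoʳ-≤ n (ℕP.+-monoʳ-≤ (row u) y≤y′)))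

  move-drift : ∀ {u v c} (m : Move u v c) → Drift u v (indelCount m)
  move-drift (del x y _ _)  = drift ℕP.≤-refl
  move-drift (ins x y _ _)  = drift (ℕP.m≤n⇒m≤1+n (ℕP.≤-trans (ℕP.n≤1+n _) (ℕP.≤-reflexive (sym (ℕP.+-suc x y)))))
  move-drift (sub x y _ _)  = drift (ℕP.≤-reflexive (sym (ℕP.+-suc x y)))
  move-drift (del⁻ x y _ _) = drift (ℕP.m≤n⇒m≤1+n (ℕP.n≤1+n _))
  move-drift (ins⁻ x y _ _) = drift (ℕP.≤-reflexive (ℕP.+-suc x y))
  move-drift (sub⁻ x y _ _) = drift (ℕP.≤-reflexive (ℕP.+-suc x y))

  path-drift : ∀ {u v} (q : Path u v) → Drift u v (indels q)
  path-drift {u} []      = drift-refl u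
  path-drift     (m ∷ q) = drift-trans (move-drift m) (path-drift q)

  drift-along : ∀ {u v} (q : Path u v) → All (λ x → Drift u x (indels q) × Drift x v (indels q)) q
  drift-along {u} []      = drift-refl u , drift-refl u
  drift-along {u} (m ∷ q) =
    (drift-mono z≤n (drift-refl u) , path-drift (m ∷ q)) ,
    All-map (λ _ (d₁ , d₂) → drift-trans (move-drift m) d₁ , drift-mono (ℕP.m≤n+m _ (indelCount m)) d₂)
            q (drift-along q)

  insertionRun : ℕ → ℕ → ℚ
  insertionRun y zero    = 0ℚ
  insertionRun y (suc n) = insCost y ℚ.+ insertionRun (suc y) n

  private
    ·-step : ∀ n {q} → 0ℚ ℚ.≤ q → n · q ℚ.≤ suc n · q
    ·-step n 0≤q = p≤q⇒p≤r+q 0≤q ℚP.≤-refl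

    ·-nonneg : ∀ n {q} → 0ℚ ℚ.≤ q → 0ℚ ℚ.≤ n · q
    ·-nonneg zero    0≤q = ℚP.≤-refl
    ·-nonneg (suc n) 0≤q = p≤q⇒p≤r+q 0≤q (·-nonneg n 0≤q)

    ∸-unfold : ∀ {a x} → x ℕ.< a → a ∸ x ≡ suc (a ∸ suc x)
    ∸-unfold x<a = ℕP.+-∸-assoc 1 x<a

    +-swapˡ : ∀ p q r → p ℚ.+ (q ℚ.+ r) ≡ q ℚ.+ (p ℚ.+ r)
    +-swapˡ p q r = trans (sym (ℚP.+-assoc p q r)) (trans (cong (ℚ._+ r) (ℚP.+-comm p q)) (ℚP.+-assoc q p r))

    insertionRun-suc : ∀ y n → insertionRun (suc y) n ℚ.≤ insertionRun y (suc n)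
    insertionRun-suc y n = p≤q⇒p≤r+q (w-≥0 _ _) ℚP.≤-refl

    restore-budget : ∀ {a x} r → x ℕ.< a → r ℚ.+ (a ∸ x) · W ℚ.≤ backCost ℚ.+ r ℚ.+ (a ∸ suc x) · W
    restore-budget {a} {x} r x<a = begin
      r ℚ.+ (a ∸ x) · W                ≡⟨ cong (λ k → r ℚ.+ k · W) (∸-unfold x<a) ⟩
      r ℚ.+ (W ℚ.+ (a ∸ suc x) · W)    ≡⟨ +-swapˡ r W _ ⟩
      W ℚ.+ (r ℚ.+ (a ∸ suc x) · W)    ≤⟨ ℚP.+-monoˡ-≤ _ W≤backCost ⟩
      backCost ℚ.+ (r ℚ.+ (a ∸ suc x) · W) ≡⟨ sym (ℚP.+-assoc backCost r _) ⟩
      backCost ℚ.+ r ℚ.+ (a ∸ suc x) · W   ∎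
      where open ℚP.≤-Reasoning

  leftward-cost : ∀ {u v} (q : Path u v) n → col v ℕ.+ n ≡ col u → n · backCost ℚ.≤ cost q
  leftward-cost     []                  zero    _ = ℚP.≤-refl
  leftward-cost {u} []                  (suc n) e = ⊥-elim (ℕP.m+1+n≢m (col u) e)
  leftward-cost     (del _ _ _ _ ∷ q)  n       e = p≤q⇒p≤r+q (w-≥0 _ _) (leftward-cost q n e)
  leftward-cost     (del⁻ _ _ _ _ ∷ q) n       e = p≤q⇒p≤r+q 0≤backCost (leftward-cost q n e)
  leftward-cost {v = v} (ins _ _ _ _ ∷ q) n e =
    p≤q⇒p≤r+q (w-≥0 _ _) (ℚP.≤-trans (·-step n 0≤backCost)
      (leftward-cost q (suc n) (trans (ℕP.+-suc (col v) n) (cong suc e))))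
  leftward-cost {v = v} (sub _ _ _ _ ∷ q) n e =
    p≤q⇒p≤r+q (w-≥0 _ _) (ℚP.≤-trans (·-step n 0≤backCost)
      (leftward-cost q (suc n) (trans (ℕP.+-suc (col v) n) (cong suc e))))
  leftward-cost (ins⁻ x y p p′ ∷ q) zero e = cost≥0 (ins⁻ x y p p′ ∷ q)
  leftward-cost {v = v} (ins⁻ _ _ _ _ ∷ q) (suc n) e =
    ℚP.+-monoʳ-≤ backCost (leftward-cost q n (ℕP.suc-injective (trans (sym (ℕP.+-suc (col v) n)) e)))
  leftward-cost (sub⁻ x y p p′ ∷ q) zero e = cost≥0 (sub⁻ x y p p′ ∷ q)
  leftward-cost {v = v} (sub⁻ _ _ _ _ ∷ q) (suc n) e =
    ℚP.+-monoʳ-≤ backCost (leftward-cost q n (ℕP.suc-injective (trans (sym (ℕP.+-suc (col v) n)) e)))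

  -- A path that stays weakly above row a can advance its column by diagonal steps only while it
  -- descends towards a; each such column is charged W ≥ insCost to the budget (a ∸ row) · W,
  -- and backward steps, costing W + 1, pay for the budget they restore.
  excursion-cost : ∀ {u a c′} (q : Path u (a , c′)) → All (λ v → row v ℕ.≤ a) q →
                   ∀ n → col u ℕ.+ n ≡ c′ → insertionRun (col u) n ℚ.≤ cost q ℚ.+ (a ∸ row u) · W
  excursion-cost {u} {a} q _ zero _ = p≤q⇒p≤q+r (·-nonneg (a ∸ row u) 0≤W) (cost≥0 q)
  excursion-cost {u} [] _ (suc n) e = ⊥-elim (ℕP.m+1+n≢m (col u) e)
  excursion-cost {a = a} (ins x y _ _ ∷ q) (_ , above) (suc n) e = begin
    insCost y ℚ.+ insertionRun (suc y) n           ≤⟨ ℚP.+-monoʳ-≤ (insCost y) (excursion-cost q above n (trans (sym (ℕP.+-suc y n)) e)) ⟩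
    insCost y ℚ.+ (cost q ℚ.+ (a ∸ x) · W)         ≡⟨ sym (ℚP.+-assoc (insCost y) (cost q) _) ⟩
    insCost y ℚ.+ cost q ℚ.+ (a ∸ x) · W           ∎
    where open ℚP.≤-Reasoning
  excursion-cost {a = a} (sub x y _ _ ∷ q) (_ , above) (suc n) e
    rewrite ∸-unfold {a} {x} (All-head q above) = begin
    insCost y ℚ.+ insertionRun (suc y) n           ≤⟨ ℚP.+-mono-≤ (w-≤W _ _) (excursion-cost q above n (trans (sym (ℕP.+-suc y n)) e)) ⟩
    W ℚ.+ (cost q ℚ.+ budget)                      ≡⟨ +-swapˡ W (cost q) budget ⟩
    cost q ℚ.+ (W ℚ.+ budget)                      ≤⟨ p≤q⇒p≤r+q (w-≥0 _ _) ℚP.≤-refl ⟩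
    subCost x y ℚ.+ (cost q ℚ.+ (W ℚ.+ budget))    ≡⟨ sym (ℚP.+-assoc (subCost x y) (cost q) _) ⟩
    subCost x y ℚ.+ cost q ℚ.+ (W ℚ.+ budget)      ∎
    where open ℚP.≤-Reasoning
          budget : ℚ
          budget = (a ∸ suc x) · W
  excursion-cost {a = a} (del x y _ _ ∷ q) (_ , above) n e
    rewrite ∸-unfold {a} {x} (All-head q above) =
    ℚP.≤-trans (excursion-cost q above n e)
      (ℚP.+-mono-≤ (p≤q⇒p≤r+q (w-≥0 _ _) ℚP.≤-refl) (p≤q⇒p≤r+q 0≤W ℚP.≤-refl))
  excursion-cost (del⁻ x y _ _ ∷ q) (x<a , above) n e =
    ℚP.≤-trans (excursion-cost q above n e) (restore-budget (cost q) x<a)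
  excursion-cost (ins⁻ x y _ _ ∷ q) (_ , above) n e =
    ℚP.≤-trans (insertionRun-suc y n)
      (ℚP.≤-trans (excursion-cost q above (suc n) (trans (ℕP.+-suc y n) e))
        (ℚP.+-monoˡ-≤ _ (p≤q⇒p≤r+q 0≤backCost ℚP.≤-refl)))
  excursion-cost (sub⁻ x y _ _ ∷ q) (x<a , above) n e =
    ℚP.≤-trans (insertionRun-suc y n)
      (ℚP.≤-trans (excursion-cost q above (suc n) (trans (ℕP.+-suc y n) e)) (restore-budget (cost q) x<a))

  module AlongRow (a : ℕ) (a≤∣X∣ : a ℕ.≤ length X) where

    Above Below : Point → Set
    Above v = row v ℕ.≤ a
    Below v = a ℕ.≤ row v

    rightward : ∀ c n {c′} → c ℕ.+ n ≡ c′ → c′ ℕ.≤ length Y →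
                Σ (Path (a , c) (a , c′)) λ h → cost h ≡ insertionRun c n × All Below h
    rightward c zero    e _ with trans (sym (ℕP.+-identityʳ c)) e
    ... | refl = [] , refl , ℕP.≤-refl
    rightward c (suc n) e c′≤ with rightward (suc c) n (trans (sym (ℕP.+-suc c n)) e) c′≤
    ... | h , cost-h , below = ins a c a≤∣X∣ c<∣Y∣ ∷ h , cong (insCost c ℚ.+_) cost-h , ℕP.≤-refl , below
      where
      c<∣Y∣ : c ℕ.< length Y
      c<∣Y∣ = ℕP.<-≤-trans (ℕP.m<m+n c (s≤s z≤n)) (ℕP.≤-trans (ℕP.≤-reflexive e) c′≤)

    leftward : ∀ c′ n {c} → n ℕ.+ c′ ≡ c → c ℕ.≤ length Y →
               Σ (Path (a , c) (a , c′)) λ h → cost h ≡ n · backCost × All Below h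
    leftward c′ zero    refl _ = [] , refl , ℕP.≤-refl
    leftward c′ (suc n) refl c≤ with leftward c′ n refl (ℕP.<⇒≤ c≤)
    ... | h , cost-h , below = ins⁻ a (n ℕ.+ c′) a≤∣X∣ c≤ ∷ h , cong (backCost ℚ.+_) cost-h , ℕP.≤-refl , below

    straighten : ∀ {c c′} (e : Path (a , c) (a , c′)) → All Above e → c ℕ.≤ length Y → c′ ℕ.≤ length Y →
                 Σ (Path (a , c) (a , c′)) λ h → cost h ℚ.≤ cost e × All Below h
    straighten {c} {c′} e above c≤ c′≤ with c ℕ.≤? c′
    ... | yes c≤c′ with rightward c (c′ ∸ c) (ℕP.m+[n∸m]≡n c≤c′) c′≤
    ...   | h , cost-h , below = h , ℚP.≤-trans (ℚP.≤-reflexive cost-h) run≤e , below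
      where
      run≤e : insertionRun c (c′ ∸ c) ℚ.≤ cost e
      run≤e = ℚP.≤-trans (excursion-cost e above (c′ ∸ c) (ℕP.m+[n∸m]≡n c≤c′))
                (ℚP.≤-reflexive (trans (cong (λ k → cost e ℚ.+ k · W) (ℕP.n∸n≡0 a)) (ℚP.+-identityʳ _)))
    straighten {c} {c′} e above c≤ c′≤ | no c≰c′ with ℕP.m∸n+n≡m (ℕP.<⇒≤ (ℕP.≰⇒> c≰c′))
    ...   | c∸c′+c′≡c with leftward c′ (c ∸ c′) c∸c′+c′≡c c≤
    ...     | h , cost-h , below =
      h , ℚP.≤-trans (ℚP.≤-reflexive cost-h) (leftward-cost e (c ∸ c′) (trans (ℕP.+-comm c′ _) c∸c′+c′≡c)) ,
          below

    mutual
      stayBelow : ∀ {u v} (q : Path u v) → Below u → Below v → InGrid u →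
                  Σ (Path u v) λ q′ → cost q′ ℚ.≤ cost q × All Below q′
      stayBelow []                              below-u _ _ = [] , ℚP.≤-refl , below-u
      stayBelow (_∷_ {v = v₁} {c = k} m r) below-u below-v grid-u with a ℕ.≤? row v₁
      ... | yes below-v₁ with stayBelow r below-v₁ below-v (move-target-inGrid m)
      ...   | r′ , cost-r′ , below-r′ = m ∷ r′ , ℚP.+-monoʳ-≤ k cost-r′ , below-u , below-r′
      stayBelow {ρ , c} (_∷_ {v = v₁} {c = k} m r) below-u below-v grid-u | no above-v₁
        with ℕP.≤-antisym (ℕP.≤-trans (move-source≤1+target m) (ℕP.≰⇒> above-v₁)) below-u
      ... | refl with returnToRow r (ℕP.≰⇒> above-v₁) below-v (move-target-inGrid m)
      ...   | c₂ , e , r′ , above-e , below-r′ , cost-er′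
              with straighten (m ∷ e) (ℕP.≤-refl , above-e) (proj₂ grid-u)
                     (proj₂ (All-last e (path-inGrid (move-target-inGrid m) e)))
      ...     | h , cost-h , below-h = h ++ₚ r′ , cost-hr′ , All-++ h r′ below-h below-r′
        where
        cost-hr′ : cost (h ++ₚ r′) ℚ.≤ k ℚ.+ cost r
        cost-hr′ = begin
          cost (h ++ₚ r′)             ≡⟨ cost-++ h r′ ⟩
          cost h ℚ.+ cost r′          ≤⟨ ℚP.+-monoˡ-≤ (cost r′) cost-h ⟩
          k ℚ.+ cost e ℚ.+ cost r′    ≡⟨ ℚP.+-assoc k (cost e) (cost r′) ⟩
          k ℚ.+ (cost e ℚ.+ cost r′)  ≤⟨ ℚP.+-monoʳ-≤ k cost-er′ ⟩
          k ℚ.+ cost r                ∎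
          where open ℚP.≤-Reasoning

      returnToRow : ∀ {u v} (r : Path u v) → row u ℕ.< a → Below v → InGrid u →
                    Σ ℕ λ c₂ → Σ (Path u (a , c₂)) λ e → Σ (Path (a , c₂) v) λ r′ →
                      All Above e × All Below r′ × (cost e ℚ.+ cost r′ ℚ.≤ cost r)
      returnToRow [] above-u below-u _ = ⊥-elim (ℕP.<⇒≱ above-u below-u)
      returnToRow (_∷_ {v = ρ₂ , c₂} {c = k} m r) above-u below-v grid-u with a ℕ.≤? ρ₂
      ... | yes below-v₁ with ℕP.≤-antisym (ℕP.≤-trans (move-target≤1+source m) above-u) below-v₁
      ...   | refl with stayBelow r below-v₁ below-v (move-target-inGrid m)
      ...     | r′ , cost-r′ , below-r′ =
        c₂ , m ∷ [] , r′ , (ℕP.<⇒≤ above-u , ℕP.≤-refl) , below-r′ ,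
        ℚP.≤-trans (ℚP.≤-reflexive (cong (ℚ._+ cost r′) (ℚP.+-identityʳ k))) (ℚP.+-monoʳ-≤ k cost-r′)
      returnToRow (_∷_ {v = ρ₂ , c₂} {c = k} m r) above-u below-v grid-u | no above-v₁
        with returnToRow r (ℕP.≰⇒> above-v₁) below-v (move-target-inGrid m)
      ... | c₃ , e , r′ , above-e , below-r′ , cost-er′ =
        c₃ , m ∷ e , r′ , (ℕP.<⇒≤ above-u , above-e) , below-r′ ,
        ℚP.≤-trans (ℚP.≤-reflexive (ℚP.+-assoc k (cost e) (cost r′))) (ℚP.+-monoʳ-≤ k cost-er′)

  splitAtRow : ∀ a {u v} (q : Path u v) → row u ℕ.≤ a → a ℕ.≤ row v →
               Σ ℕ λ c → Σ (Path u (a , c)) λ q₁ → Σ (Path (a , c) v) λ q₂ →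
                 All (λ x → row x ℕ.≤ a) q₁ × (q₁ ++ₚ q₂ ≡ q)
  splitAtRow a {ρ , c} q ρ≤a a≤v with ρ ℕ.≟ a
  splitAtRow a {ρ , c} q       ρ≤a a≤v | yes refl = c , [] , q , ρ≤a , refl
  splitAtRow a {ρ , c} []      ρ≤a a≤v | no ρ≢a   = ⊥-elim (ρ≢a (ℕP.≤-antisym ρ≤a a≤v))
  splitAtRow a {ρ , c} (m ∷ r) ρ≤a a≤v | no ρ≢a
    with splitAtRow a r (ℕP.≤-trans (move-target≤1+source m) (ℕP.≤∧≢⇒< ρ≤a ρ≢a)) a≤v
  ... | c₁ , q₁ , q₂ , above , refl = c₁ , m ∷ q₁ , q₂ , (ρ≤a , above) , refl

-- Occurrences of factors

module _ {A : Set} where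

  at-++ˡ : ∀ (xs ys : List A) {i} → i ℕ.< length xs → at (xs ++ ys) i ≡ at xs i
  at-++ˡ (x ∷ₗ xs) ys {zero}  _       = refl
  at-++ˡ (x ∷ₗ xs) ys {suc i} (s≤s p) = at-++ˡ xs ys p

  at-++ʳ : ∀ (xs ys : List A) j → at (xs ++ ys) (length xs ℕ.+ j) ≡ at ys j
  at-++ʳ []ₗ       ys j = refl
  at-++ʳ (x ∷ₗ xs) ys j = at-++ʳ xs ys j

  at-drop : ∀ d (xs : List A) j → at (drop d xs) j ≡ at xs (d ℕ.+ j)
  at-drop zero    xs        j = refl
  at-drop (suc d) []ₗ       j = refl
  at-drop (suc d) (x ∷ₗ xs) j = at-drop d xs j

  at-take : ∀ t (xs : List A) {j} → j ℕ.< t → at (take t xs) j ≡ at xs j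
  at-take (suc t) []ₗ       _       = refl
  at-take (suc t) (x ∷ₗ xs) {zero}  _       = refl
  at-take (suc t) (x ∷ₗ xs) {suc j} (s≤s p) = at-take t xs p

  record OccursAt (X : List A) (o : ℕ) (P : List A) : Set where
    field
      fits   : o ℕ.+ length X ℕ.≤ length P
      agrees : ∀ {q} → q ℕ.< length X → at X q ≡ at P (o ℕ.+ q)
  open OccursAt public

  occurs-refl : ∀ S → OccursAt S 0 S
  occurs-refl S = record { fits = ℕP.≤-refl ; agrees = λ _ → refl }

  occurs-trans : ∀ {X Y P o o′} → OccursAt X o Y → OccursAt Y o′ P → OccursAt X (o′ ℕ.+ o) P
  occurs-trans {X} {P = P} {o} {o′} X-in-Y Y-in-P = record
    { fits   = ℕP.≤-trans (ℕP.≤-reflexive (ℕP.+-assoc o′ o (length X)))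
                 (ℕP.≤-trans (ℕP.+-monoʳ-≤ o′ (fits X-in-Y)) (fits Y-in-P))
    ; agrees = λ {q} q< →
        trans (agrees X-in-Y q<)
          (trans (agrees Y-in-P (ℕP.<-≤-trans (ℕP.+-monoʳ-< o q<) (fits X-in-Y)))
            (cong (at P) (sym (ℕP.+-assoc o′ o q))))
    }

  take-occurs : ∀ n S → OccursAt (take n S) 0 S
  take-occurs n S = record
    { fits   = ℕP.≤-trans (ℕP.≤-reflexive (ListP.length-take n S)) (ℕP.m⊓n≤n n (length S))
    ; agrees = λ q< → at-take n S (ℕP.<-≤-trans q< (ℕP.≤-trans (ℕP.≤-reflexive (ListP.length-take n S))
                                                                (ℕP.m⊓n≤m n (length S))))
    }

  drop-occurs : ∀ n S → n ℕ.≤ length S → OccursAt (drop n S) n S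
  drop-occurs n S n≤ = record
    { fits   = ℕP.≤-reflexive (trans (cong (n ℕ.+_) (ListP.length-drop n S)) (ℕP.m+[n∸m]≡n n≤))
    ; agrees = λ {q} _ → at-drop n S q
    }

  ++-occursˡ : ∀ G H → OccursAt G 0 (G ++ H)
  ++-occursˡ G H = record
    { fits   = ℕP.≤-trans (ℕP.m≤m+n (length G) (length H)) (ℕP.≤-reflexive (sym (ListP.length-++ G)))
    ; agrees = λ q< → sym (at-++ˡ G H q<)
    }

  ++-occursʳ : ∀ G H → OccursAt H (length G) (G ++ H)
  ++-occursʳ G H = record
    { fits   = ℕP.≤-reflexive (sym (ListP.length-++ G))
    ; agrees = λ {q} _ → sym (at-++ʳ G H q)
    }

  occurs-split : ∀ Δ S {o G} → Δ ℕ.≤ length S →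
                 OccursAt (take Δ S) o G → OccursAt (drop Δ S) (o ℕ.+ Δ) G → OccursAt S o G
  occurs-split Δ S {o} {G} Δ≤ head-in-G tail-in-G = record
    { fits   = ℕP.≤-trans (ℕP.≤-reflexive length-eq) (fits tail-in-G)
    ; agrees = agrees′
    }
    where
    length-eq : o ℕ.+ length S ≡ o ℕ.+ Δ ℕ.+ length (drop Δ S)
    length-eq = begin
      o ℕ.+ length S                  ≡⟨ cong (o ℕ.+_) (sym (ℕP.m+[n∸m]≡n Δ≤)) ⟩
      o ℕ.+ (Δ ℕ.+ (length S ∸ Δ))    ≡⟨ sym (ℕP.+-assoc o Δ _) ⟩
      o ℕ.+ Δ ℕ.+ (length S ∸ Δ)      ≡⟨ cong (o ℕ.+ Δ ℕ.+_) (sym (ListP.length-drop Δ S)) ⟩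
      o ℕ.+ Δ ℕ.+ length (drop Δ S)   ∎
      where open ≡-Reasoning
    agrees′ : ∀ {q} → q ℕ.< length S → at S q ≡ at G (o ℕ.+ q)
    agrees′ {q} q< with q ℕ.<? Δ
    ... | yes q<Δ = trans (sym (at-take Δ S q<Δ))
                      (agrees head-in-G (ℕP.<-≤-trans q<Δ (ℕP.≤-reflexive
                        (sym (trans (ListP.length-take Δ S) (ℕP.m≤n⇒m⊓n≡m Δ≤))))))
    ... | no q≮Δ with ℕP.m+[n∸m]≡n (ℕP.≮⇒≥ q≮Δ)
    ...   | Δ+[q∸Δ]≡q = begin
      at S q                          ≡⟨ cong (at S) (sym Δ+[q∸Δ]≡q) ⟩
      at S (Δ ℕ.+ (q ∸ Δ))            ≡⟨ sym (at-drop Δ S (q ∸ Δ)) ⟩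
      at (drop Δ S) (q ∸ Δ)           ≡⟨ agrees tail-in-G q∸Δ< ⟩
      at G (o ℕ.+ Δ ℕ.+ (q ∸ Δ))      ≡⟨ cong (at G) (trans (ℕP.+-assoc o Δ _) (cong (o ℕ.+_) Δ+[q∸Δ]≡q)) ⟩
      at G (o ℕ.+ q)                  ∎
      where
      open ≡-Reasoning
      q∸Δ< : q ∸ Δ ℕ.< length (drop Δ S)
      q∸Δ< = ℕP.<-≤-trans (ℕP.∸-monoˡ-< q< (ℕP.≮⇒≥ q≮Δ)) (ℕP.≤-reflexive (sym (ListP.length-drop Δ S)))

module Glue {A : Set} (Δ : ℕ) (F : ℕ → List A) (Z : ℕ)
  (Δ≤∣F∣ : ∀ s → s ℕ.≤ Z → Δ ℕ.≤ length (F s))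
  (overlaps : ∀ s → s ℕ.< Z → drop (length (F s) ∸ Δ) (F s) ≡ take Δ (F (suc s))) where

  offset : ℕ → ℕ
  offset s = sumTo s (λ t → length (F t) ∸ Δ)

  offset-suc : ∀ s → s ℕ.≤ Z → offset (suc s) ℕ.+ Δ ≡ offset s ℕ.+ length (F s)
  offset-suc s s≤Z = trans (ℕP.+-assoc (offset s) _ Δ) (cong (offset s ℕ.+_) (ℕP.m∸n+n≡m (Δ≤∣F∣ s s≤Z)))

  length-glue : ∀ n → n ℕ.≤ Z → length (glue Δ F n) ≡ offset n ℕ.+ length (F n)
  length-glue zero    _   = refl
  length-glue (suc n) n<Z = begin
    length (glue Δ F n ++ drop Δ (F (suc n)))                  ≡⟨ ListP.length-++ (glue Δ F n) ⟩
    length (glue Δ F n) ℕ.+ length (drop Δ (F (suc n)))       ≡⟨ cong₂ ℕ._+_ (length-glue n (ℕP.<⇒≤ n<Z)) (ListP.length-drop Δ (F (suc n))) ⟩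
    offset n ℕ.+ length (F n) ℕ.+ (length (F (suc n)) ∸ Δ)    ≡⟨ cong (ℕ._+ (length (F (suc n)) ∸ Δ)) (sym (offset-suc n (ℕP.<⇒≤ n<Z))) ⟩
    offset (suc n) ℕ.+ Δ ℕ.+ (length (F (suc n)) ∸ Δ)         ≡⟨ ℕP.+-assoc (offset (suc n)) Δ _ ⟩
    offset (suc n) ℕ.+ (Δ ℕ.+ (length (F (suc n)) ∸ Δ))       ≡⟨ cong (offset (suc n) ℕ.+_) (ℕP.m+[n∸m]≡n (Δ≤∣F∣ (suc n) n<Z)) ⟩
    offset (suc n) ℕ.+ length (F (suc n))                     ∎
    where open ≡-Reasoning

  piece-occurs : ∀ {s n} → s ℕ.≤ n → n ℕ.≤ Z → OccursAt (F s) (offset s) (glue Δ F n)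
  piece-occurs {zero} {zero}  _   _   = occurs-refl (F 0)
  piece-occurs {s}    {suc n} s≤ n<Z with ℕP.m≤n⇒m<n∨m≡n s≤
  ... | inj₁ s≤n  = occurs-trans (piece-occurs (ℕP.≤-pred s≤n) (ℕP.<⇒≤ n<Z)) (++-occursˡ _ _)
  ... | inj₂ refl = occurs-split Δ (F (suc n)) (Δ≤∣F∣ (suc n) n<Z) overlap-occurs new-part-occurs
    where
    overlap-occurs : OccursAt (take Δ (F (suc n))) (offset (suc n)) (glue Δ F (suc n))
    overlap-occurs = subst (λ S → OccursAt S (offset (suc n)) (glue Δ F (suc n))) (overlaps n n<Z)
      (occurs-trans (occurs-trans (drop-occurs _ (F n) (ℕP.m∸n≤m _ Δ)) (piece-occurs ℕP.≤-refl (ℕP.<⇒≤ n<Z)))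
                    (++-occursˡ _ _))
    new-part-occurs : OccursAt (drop Δ (F (suc n))) (offset (suc n) ℕ.+ Δ) (glue Δ F (suc n))
    new-part-occurs = subst (λ o → OccursAt (drop Δ (F (suc n))) o (glue Δ F (suc n)))
      (trans (length-glue n (ℕP.<⇒≤ n<Z)) (sym (offset-suc n (ℕP.<⇒≤ n<Z))))
      (++-occursʳ (glue Δ F n) _)

-- The alignment graph of a pair of factors inside that of P and T

module Window {A : Set} (ω : NormalizedWeight A) {X Y P T : List A} {ox oy : ℕ}
  (X-in-P : OccursAt X ox P) (Y-in-T : OccursAt Y oy T) where
  open NormalizedWeight ω
  module Small = AlignmentPaths ω X Y
  module Large = AlignmentPaths ω P T
  open AlignmentPaths using ([]; _∷_; del; ins; sub; del⁻; ins⁻; sub⁻)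

  shift unshift : Point → Point
  shift   (x , y) = ox ℕ.+ x , oy ℕ.+ y
  unshift (x , y) = x ∸ ox , y ∸ oy

  InWindow : Point → Set
  InWindow (x , y) = (ox ℕ.≤ x × x ℕ.≤ ox ℕ.+ length X) × (oy ℕ.≤ y × y ℕ.≤ oy ℕ.+ length Y)

  private
    castL : ∀ {u u′ v v′ k k′} → u ≡ u′ → v ≡ v′ → k ≡ k′ → Large.Move u v k → Large.Move u′ v′ k′
    castL refl refl refl m = m

    castS : ∀ {u u′ v v′ k k′} → u ≡ u′ → v ≡ v′ → k ≡ k′ → Small.Move u v k → Small.Move u′ v′ k′
    castS refl refl refl m = m

    shift-< : ∀ {o i n N} → i ℕ.< n → o ℕ.+ n ℕ.≤ N → o ℕ.+ i ℕ.< N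
    shift-< {o} i<n fits = ℕP.<-≤-trans (ℕP.+-monoʳ-< o i<n) fits

    shift-≤ : ∀ {o i n N} → i ℕ.≤ n → o ℕ.+ n ℕ.≤ N → o ℕ.+ i ℕ.≤ N
    shift-≤ {o} i≤n fits = ℕP.≤-trans (ℕP.+-monoʳ-≤ o i≤n) fits

    unshift-≤ : ∀ {o i n} → i ℕ.≤ o ℕ.+ n → i ∸ o ℕ.≤ n
    unshift-≤ {o} {i} = ℕP.m≤n+o⇒m∸n≤o i o

    unshift-< : ∀ {o i n} → o ℕ.≤ i → suc i ℕ.≤ o ℕ.+ n → i ∸ o ℕ.< n
    unshift-< {o} {i} {n} o≤i i<o+n = subst (ℕ._≤ n) (ℕP.+-∸-assoc 1 o≤i) (unshift-≤ {o} {suc i} i<o+n)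

    unshift-suc : ∀ {o i} → o ℕ.≤ i → suc i ∸ o ≡ suc (i ∸ o)
    unshift-suc o≤i = ℕP.+-∸-assoc 1 o≤i

    reshift : ∀ {o i} → o ℕ.≤ i → o ℕ.+ (i ∸ o) ≡ i
    reshift = ℕP.m+[n∸m]≡n

    X-fits : ox ℕ.+ length X ℕ.≤ length P
    X-fits = fits X-in-P

    Y-fits : oy ℕ.+ length Y ℕ.≤ length T
    Y-fits = fits Y-in-T

  embed-move : ∀ {u v k} → Small.Move u v k → Large.Move (shift u) (shift v) k
  embed-move (del x y p q) =
    castL refl (cong (_, oy ℕ.+ y) (sym (ℕP.+-suc ox x))) (cong (λ a → w a nothing) (sym (agrees X-in-P p)))
      (del (ox ℕ.+ x) (oy ℕ.+ y) (shift-< p X-fits) (shift-≤ q Y-fits))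
  embed-move (ins x y p q) =
    castL refl (cong (ox ℕ.+ x ,_) (sym (ℕP.+-suc oy y))) (cong (w nothing) (sym (agrees Y-in-T q)))
      (ins (ox ℕ.+ x) (oy ℕ.+ y) (shift-≤ p X-fits) (shift-< q Y-fits))
  embed-move (sub x y p q) =
    castL refl (cong₂ _,_ (sym (ℕP.+-suc ox x)) (sym (ℕP.+-suc oy y))) (cong₂ w (sym (agrees X-in-P p)) (sym (agrees Y-in-T q)))
      (sub (ox ℕ.+ x) (oy ℕ.+ y) (shift-< p X-fits) (shift-< q Y-fits))
  embed-move (del⁻ x y p q) =
    castL (cong (_, oy ℕ.+ y) (sym (ℕP.+-suc ox x))) refl refl
      (del⁻ (ox ℕ.+ x) (oy ℕ.+ y) (shift-< p X-fits) (shift-≤ q Y-fits))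
  embed-move (ins⁻ x y p q) =
    castL (cong (ox ℕ.+ x ,_) (sym (ℕP.+-suc oy y))) refl refl
      (ins⁻ (ox ℕ.+ x) (oy ℕ.+ y) (shift-≤ p X-fits) (shift-< q Y-fits))
  embed-move (sub⁻ x y p q) =
    castL (cong₂ _,_ (sym (ℕP.+-suc ox x)) (sym (ℕP.+-suc oy y))) refl refl
      (sub⁻ (ox ℕ.+ x) (oy ℕ.+ y) (shift-< p X-fits) (shift-< q Y-fits))

  embed : ∀ {u v} (q : Small.Path u v) → Σ (Large.Path (shift u) (shift v)) λ q′ → Large.cost q′ ≡ Small.cost q
  embed []                  = [] , refl
  embed (_∷_ {c = k} m q) with embed q
  ... | q′ , e = embed-move m ∷ q′ , cong (k ℚ.+_) e

  restrict-move : ∀ {u v k} → Large.Move u v k → InWindow u → InWindow v → Small.Move (unshift u) (unshift v) k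
  restrict-move (del x y _ _) ((ox≤x , _) , (oy≤y , y≤)) ((_ , x<) , _) =
    castS refl (cong (_, y ∸ oy) (sym (unshift-suc ox≤x)))
      (cong (λ a → w a nothing) (trans (agrees X-in-P x-ox<) (cong (at P) (reshift ox≤x))))
      (del (x ∸ ox) (y ∸ oy) x-ox< (unshift-≤ y≤))
    where
    x-ox< : x ∸ ox ℕ.< length X
    x-ox< = unshift-< ox≤x x<
  restrict-move (ins x y _ _) ((_ , x≤) , (oy≤y , _)) (_ , (_ , y<)) =
    castS refl (cong (x ∸ ox ,_) (sym (unshift-suc oy≤y)))
      (cong (w nothing) (trans (agrees Y-in-T y-oy<) (cong (at T) (reshift oy≤y))))
      (ins (x ∸ ox) (y ∸ oy) (unshift-≤ x≤) y-oy<)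
    where
    y-oy< : y ∸ oy ℕ.< length Y
    y-oy< = unshift-< oy≤y y<
  restrict-move (sub x y _ _) ((ox≤x , _) , (oy≤y , _)) ((_ , x<) , (_ , y<)) =
    castS refl (cong₂ _,_ (sym (unshift-suc ox≤x)) (sym (unshift-suc oy≤y)))
      (cong₂ w (trans (agrees X-in-P x-ox<) (cong (at P) (reshift ox≤x)))
               (trans (agrees Y-in-T y-oy<) (cong (at T) (reshift oy≤y))))
      (sub (x ∸ ox) (y ∸ oy) x-ox< y-oy<)
    where
    x-ox< : x ∸ ox ℕ.< length X
    x-ox< = unshift-< ox≤x x<
    y-oy< : y ∸ oy ℕ.< length Y
    y-oy< = unshift-< oy≤y y<
  restrict-move (del⁻ x y _ _) ((_ , x<) , (_ , y≤)) ((ox≤x , _) , _) =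
    castS (cong (_, y ∸ oy) (sym (unshift-suc ox≤x))) refl refl
      (del⁻ (x ∸ ox) (y ∸ oy) (unshift-< ox≤x x<) (unshift-≤ y≤))
  restrict-move (ins⁻ x y _ _) ((_ , x≤) , (_ , y<)) (_ , (oy≤y , _)) =
    castS (cong (x ∸ ox ,_) (sym (unshift-suc oy≤y))) refl refl
      (ins⁻ (x ∸ ox) (y ∸ oy) (unshift-≤ x≤) (unshift-< oy≤y y<))
  restrict-move (sub⁻ x y _ _) ((_ , x<) , (_ , y<)) ((ox≤x , _) , (oy≤y , _)) =
    castS (cong₂ _,_ (sym (unshift-suc ox≤x)) (sym (unshift-suc oy≤y))) refl refl
      (sub⁻ (x ∸ ox) (y ∸ oy) (unshift-< ox≤x x<) (unshift-< oy≤y y<))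

  restrict : ∀ {u v} (q : Large.Path u v) → Large.All InWindow q →
             Σ (Small.Path (unshift u) (unshift v)) λ q′ → Small.cost q′ ≡ Large.cost q
  restrict []                  _              = [] , refl
  restrict (_∷_ {c = k} m q) (in-u , in-q) with restrict q in-q
  ... | q′ , e = restrict-move m in-u (Large.All-head q in-q) ∷ q′ , cong (k ℚ.+_) e

  embed-dist : ∀ {u₀ v₀ u v d} → shift u₀ ≡ u → shift v₀ ≡ v → IsDist ω X Y u₀ v₀ d →
               Σ (Large.Path u v) λ q → Large.cost q ≡ d
  embed-dist refl refl dist with Small.dist-realised dist
  ... | q , cost-q with embed q
  ...   | q′ , cost-q′ = q′ , trans cost-q′ cost-q

  dist-≤-restricted : ∀ {u₀ v₀ u v d} → unshift u ≡ u₀ → unshift v ≡ v₀ → IsDist ω X Y u₀ v₀ d →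
                      (q : Large.Path u v) → Large.All InWindow q → d ℚ.≤ Large.cost q
  dist-≤-restricted refl refl dist q in-q with restrict q in-q
  ... | q′ , cost-q′ = ℚP.≤-trans (Small.dist-minimal dist q′) (ℚP.≤-reflexive cost-q′)

-- Cutting P and T into pieces

module Decomposition {A : Set} (ω : NormalizedWeight A) (Δ z′ : ℕ) (Ṗ Ṫ : ℕ → List A)
  (Δ≤∣Ṗ∣ : ∀ s → s ℕ.≤ suc z′ → Δ ℕ.≤ length (Ṗ s))
  (Δ≤∣Ṫ∣ : ∀ s → s ℕ.≤ suc z′ → Δ ℕ.≤ length (Ṫ s))
  (Ṗ-overlaps : ∀ s → s ℕ.< suc z′ → drop (length (Ṗ s) ∸ Δ) (Ṗ s) ≡ take Δ (Ṗ (suc s)))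
  (Ṫ-overlaps : ∀ s → s ℕ.< suc z′ → drop (length (Ṫ s) ∸ Δ) (Ṫ s) ≡ take Δ (Ṫ (suc s))) where

  Z : ℕ
  Z = suc z′

  module GlueP = Glue Δ Ṗ Z Δ≤∣Ṗ∣ Ṗ-overlaps
  module GlueT = Glue Δ Ṫ Z Δ≤∣Ṫ∣ Ṫ-overlaps

  P T : List A
  P = glue Δ Ṗ Z
  T = glue Δ Ṫ Z

  O U : ℕ → ℕ
  O = GlueP.offset
  U = GlueT.offset

  half : ℕ
  half = Δ ℕ./ 2

  half≤Δ : half ℕ.≤ Δ
  half≤Δ = ℕDM.m/n≤m Δ 2

  -- Piece s ≥ 1 starts in the middle of its overlap with piece s − 1, as in D^int and D^trail.
  cutRow : ℕ → ℕ
  cutRow zero    = 0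
  cutRow (suc s) = O (suc s) ℕ.+ half

  text-occurs : ∀ {t} → t ℕ.≤ Z → OccursAt (Ṫ t) (U t) T
  text-occurs t≤Z = GlueT.piece-occurs t≤Z ℕP.≤-refl

  cutRow-mono : ∀ t → cutRow t ℕ.≤ cutRow (suc t)
  cutRow-mono zero    = z≤n
  cutRow-mono (suc t) = ℕP.+-monoˡ-≤ half (ℕP.m≤m+n _ _)

  cutRow≤∣P∣ : ∀ t → t ℕ.≤ Z → cutRow t ℕ.≤ length P
  cutRow≤∣P∣ zero    _   = z≤n
  cutRow≤∣P∣ (suc t) t<Z = ℕP.≤-trans (ℕP.+-monoʳ-≤ (O (suc t)) (ℕP.≤-trans half≤Δ (Δ≤∣Ṗ∣ (suc t) t<Z)))
                                      (fits (GlueP.piece-occurs t<Z ℕP.≤-refl))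

  record Piece (t endRow exitCol : ℕ) (M : Matrix Δ) : Set where
    field
      fragment        : List A
      fragment-occurs : OccursAt fragment (cutRow t) P
      fragment-ends   : cutRow t ℕ.+ length fragment ≡ endRow
      index≤Z         : t ℕ.≤ Z
      text-exit       : U t ℕ.+ (length (Ṫ t) ∸ Δ) ≡ exitCol
      isD             : IsD ω Δ fragment (Ṫ t) M
  open Piece

  private
    length-Xlead : ∀ s → s ℕ.≤ Z → length (Xlead Δ (Ṗ s)) ≡ (length (Ṗ s) ∸ Δ) ℕ.+ half
    length-Xlead s s≤Z = begin
      length (Xlead Δ (Ṗ s))               ≡⟨ ListP.length-take _ (Ṗ s) ⟩
      (L ∸ ceilHalf Δ) ℕ.⊓ L              ≡⟨ ℕP.m≤n⇒m⊓n≡m (ℕP.m∸n≤m L (ceilHalf Δ)) ⟩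
      L ∸ ceilHalf Δ                       ≡⟨ cong (_∸ ceilHalf Δ) L≡ ⟩
      (L ∸ Δ) ℕ.+ half ℕ.+ ceilHalf Δ ∸ ceilHalf Δ ≡⟨ ℕP.m+n∸n≡m _ (ceilHalf Δ) ⟩
      (L ∸ Δ) ℕ.+ half                     ∎
      where
      open ≡-Reasoning
      L : ℕ
      L = length (Ṗ s)
      L≡ : L ≡ (L ∸ Δ) ℕ.+ half ℕ.+ ceilHalf Δ
      L≡ = sym (trans (ℕP.+-assoc (L ∸ Δ) half _)
                 (trans (cong ((L ∸ Δ) ℕ.+_) (ℕP.m+[n∸m]≡n half≤Δ)) (ℕP.m∸n+n≡m (Δ≤∣Ṗ∣ s s≤Z))))

  lead-piece : ∀ {M} → IsDlead ω Δ (Ṗ 0) (Ṫ 0) M → Piece 0 (cutRow 1) (U 1) M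
  lead-piece isD-lead = record
    { fragment        = Xlead Δ (Ṗ 0)
    ; fragment-occurs = occurs-trans (take-occurs _ (Ṗ 0)) (GlueP.piece-occurs z≤n ℕP.≤-refl)
    ; fragment-ends   = length-Xlead 0 z≤n
    ; index≤Z         = z≤n
    ; text-exit       = refl
    ; isD             = isD-lead
    }

  int-piece : ∀ {M} s → s ℕ.< Z → IsDint ω Δ (Ṗ (suc s)) (Ṫ (suc s)) M → Piece (suc s) (cutRow (suc (suc s))) (U (suc (suc s))) M
  int-piece s s<Z isD-int = record
    { fragment        = Xint Δ (Ṗ (suc s))
    ; fragment-occurs = occurs-trans (occurs-trans (drop-occurs half _ half≤) (take-occurs _ (Ṗ (suc s))))
                                    (GlueP.piece-occurs s<Z ℕP.≤-refl)
    ; fragment-ends   = ends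
    ; index≤Z         = s<Z
    ; text-exit       = refl
    ; isD             = isD-int
    }
    where
    L : ℕ
    L = length (Ṗ (suc s))
    length-kept : length (Xlead Δ (Ṗ (suc s))) ≡ (L ∸ Δ) ℕ.+ half
    length-kept = length-Xlead (suc s) s<Z
    half≤ : half ℕ.≤ length (Xlead Δ (Ṗ (suc s)))
    half≤ = ℕP.≤-trans (ℕP.m≤n+m half (L ∸ Δ)) (ℕP.≤-reflexive (sym length-kept))
    ends : cutRow (suc s) ℕ.+ length (Xint Δ (Ṗ (suc s))) ≡ cutRow (suc (suc s))
    ends = begin
      O (suc s) ℕ.+ half ℕ.+ length (Xint Δ (Ṗ (suc s)))  ≡⟨ cong (O (suc s) ℕ.+ half ℕ.+_) (ListP.length-drop half _) ⟩
      O (suc s) ℕ.+ half ℕ.+ (length (Xlead Δ (Ṗ (suc s))) ∸ half)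
                                                          ≡⟨ cong (λ n → O (suc s) ℕ.+ half ℕ.+ (n ∸ half)) length-kept ⟩
      O (suc s) ℕ.+ half ℕ.+ ((L ∸ Δ) ℕ.+ half ∸ half)   ≡⟨ cong (O (suc s) ℕ.+ half ℕ.+_) (ℕP.m+n∸n≡m (L ∸ Δ) half) ⟩
      O (suc s) ℕ.+ half ℕ.+ (L ∸ Δ)                     ≡⟨ swap (O (suc s)) half (L ∸ Δ) ⟩
      O (suc s) ℕ.+ (L ∸ Δ) ℕ.+ half                     ∎
      where
      open ≡-Reasoning
      swap : ∀ a b c → a ℕ.+ b ℕ.+ c ≡ a ℕ.+ c ℕ.+ b
      swap = solve-∀

  trail-piece : ∀ {M} → IsDtrail ω Δ (Ṗ Z) (Ṫ Z) M → Piece Z (length P) (length T ∸ Δ) M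
  trail-piece isD-trail = record
    { fragment        = Xtrail Δ (Ṗ Z)
    ; fragment-occurs = occurs-trans (drop-occurs half (Ṗ Z) half≤) (GlueP.piece-occurs ℕP.≤-refl ℕP.≤-refl)
    ; fragment-ends   = begin
        O Z ℕ.+ half ℕ.+ length (drop half (Ṗ Z))  ≡⟨ cong (O Z ℕ.+ half ℕ.+_) (ListP.length-drop half (Ṗ Z)) ⟩
        O Z ℕ.+ half ℕ.+ (length (Ṗ Z) ∸ half)     ≡⟨ ℕP.+-assoc (O Z) half _ ⟩
        O Z ℕ.+ (half ℕ.+ (length (Ṗ Z) ∸ half))   ≡⟨ cong (O Z ℕ.+_) (ℕP.m+[n∸m]≡n half≤) ⟩
        O Z ℕ.+ length (Ṗ Z)                       ≡⟨ sym (GlueP.length-glue Z ℕP.≤-refl) ⟩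
        length P                                   ∎
    ; index≤Z         = ℕP.≤-refl
    ; text-exit       = trans (sym (ℕP.+-∸-assoc (U Z) (Δ≤∣Ṫ∣ Z ℕP.≤-refl)))
                              (cong (_∸ Δ) (sym (GlueT.length-glue Z ℕP.≤-refl)))
    ; isD             = isD-trail
    }
    where
    open ≡-Reasoning
    half≤ : half ℕ.≤ length (Ṗ Z)
    half≤ = ℕP.≤-trans half≤Δ (Δ≤∣Ṗ∣ Z ℕP.≤-refl)

  open AlignmentPaths ω P T

  target : Fin (suc Δ) → ℕ
  target j = (length T ∸ Δ) ℕ.+ toℕ j

  module _ {t endRow exitCol M} (pc : Piece t endRow exitCol M) where
    private
      module W = Window ω (fragment-occurs pc) (text-occurs (index≤Z pc))

      exit-col : ∀ x → U t ℕ.+ ((length (Ṫ t) ∸ Δ) ℕ.+ x) ≡ exitCol ℕ.+ x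
      exit-col x = trans (sym (ℕP.+-assoc (U t) _ x)) (cong (ℕ._+ x) (text-exit pc))

    InPiece : Point → Set
    InPiece = W.InWindow

    piece-path : ∀ l l′ → Σ (Path (cutRow t , U t ℕ.+ toℕ l) (endRow , exitCol ℕ.+ toℕ l′)) λ q → cost q ≡ M l l′
    piece-path l l′ = W.embed-dist (cong (_, U t ℕ.+ toℕ l) (ℕP.+-identityʳ (cutRow t)))
                                   (cong₂ _,_ (fragment-ends pc) (exit-col (toℕ l′)))
                                   (isD pc l l′)

    piece-bound : ∀ l l′ {c₁ c₂} → c₁ ≡ U t ℕ.+ toℕ l → c₂ ≡ exitCol ℕ.+ toℕ l′ →
                  (q : Path (cutRow t , c₁) (endRow , c₂)) → All InPiece q → M l l′ ℚ.≤ cost q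
    piece-bound l l′ refl refl = W.dist-≤-restricted
      (cong₂ _,_ (ℕP.n∸n≡0 (cutRow t)) (ℕP.m+n∸m≡n (U t) (toℕ l)))
      (cong₂ _,_ (trans (cong (_∸ cutRow t) (sym (fragment-ends pc))) (ℕP.m+n∸m≡n (cutRow t) _))
                 (trans (cong (_∸ U t) (sym (exit-col (toℕ l′)))) (ℕP.m+n∸m≡n (U t) _)))
      (isD pc l l′)

  InLayer : ℕ → Point → Set
  InLayer t v = cutRow t ℕ.≤ row v × row v ℕ.≤ cutRow (suc t)

  Layered : ℕ → ℕ → ℕ → ℕ → Set
  Layered E zero    t c = Σ (Path (cutRow t , c) (length P , E)) (All (λ v → cutRow t ℕ.≤ row v))
  Layered E (suc n) t c = Σ ℕ λ c′ → Σ (Path (cutRow t , c) (cutRow (suc t) , c′)) λ q →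
                            All (InLayer t) q × Layered E n (suc t) c′

  flatten : ∀ {E} n {t c} → Layered E n t c → Path (cutRow t , c) (length P , E)
  flatten zero    (q , _)            = q
  flatten (suc n) (_ , q , _ , rest) = q ++ₚ flatten n rest

  index<Z : ∀ {t n} → t ℕ.+ suc n ≡ Z → t ℕ.< Z
  index<Z {t} e = subst (t ℕ.<_) e (ℕP.m<m+n t (s≤s z≤n))

  layer : ∀ {E} n t {c} → t ℕ.+ n ≡ Z → (q : Path (cutRow t , c) (length P , E)) →
          All (λ v → cutRow t ℕ.≤ row v) q → InGrid (cutRow t , c) →
          Σ (Layered E n t c) λ ly → cost (flatten n ly) ℚ.≤ cost q
  layer zero    t e q below _ = (q , below) , ℚP.≤-refl
  layer (suc n) t e q below grid
    with splitAtRow (cutRow (suc t)) q (cutRow-mono t) (cutRow≤∣P∣ (suc t) (index<Z e))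
  ... | c₁ , q₁ , q₂ , above₁ , refl
    with All-last q₁ (All-++⁻ˡ q₁ q₂ (path-inGrid grid (q₁ ++ₚ q₂)))
  ... | grid₁ with AlongRow.stayBelow (cutRow (suc t)) (cutRow≤∣P∣ (suc t) (index<Z e))
                     q₂ ℕP.≤-refl (cutRow≤∣P∣ (suc t) (index<Z e)) grid₁
  ... | q₂′ , cost-q₂′ , below₂ with layer n (suc t) (trans (sym (ℕP.+-suc t n)) e) q₂′ below₂ grid₁
  ... | ly , cost-ly =
    (c₁ , q₁ , All-zip q₁ (All-++⁻ˡ q₁ q₂ below) above₁ , ly) , (begin
      cost (q₁ ++ₚ flatten n ly)        ≡⟨ cost-++ q₁ (flatten n ly) ⟩
      cost q₁ ℚ.+ cost (flatten n ly)   ≤⟨ ℚP.+-monoʳ-≤ (cost q₁) (ℚP.≤-trans cost-ly cost-q₂′) ⟩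
      cost q₁ ℚ.+ cost q₂               ≡⟨ sym (cost-++ q₁ q₂) ⟩
      cost (q₁ ++ₚ q₂)                  ∎)
    where open ℚP.≤-Reasoning

  Band : ℕ → Point → Set
  Band N v = Drift (0 , 0) v N × Drift v (length P , length T) N

  module Confined (N : ℕ)
    (skew-lo : ∀ t → t ℕ.< Z → U (suc t) ℕ.+ N ℕ.≤ cutRow (suc t))
    (skew-hi : ∀ t → t ℕ.< Z → N ℕ.+ (cutRow (suc t) ℕ.+ length T) ℕ.≤ length P ℕ.+ (U t ℕ.+ length (Ṫ t))) where

    col-lower : ∀ t → t ℕ.≤ Z → ∀ {v} → cutRow t ℕ.≤ row v → Band N v → U t ℕ.≤ col v
    col-lower zero    _   _ _ = z≤n
    col-lower (suc t) t<Z {ρ , c} cut≤ρ (drift d , _) = ℕP.+-cancelʳ-≤ N (U (suc t)) c (begin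
      U (suc t) ℕ.+ N   ≤⟨ skew-lo t t<Z ⟩
      cutRow (suc t)    ≤⟨ cut≤ρ ⟩
      ρ                 ≤⟨ ℕP.m≤m+n ρ 0 ⟩
      ρ ℕ.+ 0           ≤⟨ d ⟩
      N ℕ.+ c           ≡⟨ ℕP.+-comm N c ⟩
      c ℕ.+ N           ∎)
      where open ℕP.≤-Reasoning

    col-upper : ∀ t → t ℕ.< Z → ∀ {v} → row v ℕ.≤ cutRow (suc t) → Band N v → col v ℕ.≤ U t ℕ.+ length (Ṫ t)
    col-upper t t<Z {ρ , c} ρ≤cut (_ , drift d) = ℕP.+-cancelˡ-≤ (length P) c _ (begin
      length P ℕ.+ c                      ≤⟨ d ⟩
      N ℕ.+ (ρ ℕ.+ length T)              ≤⟨ ℕP.+-monoʳ-≤ N (ℕP.+-monoˡ-≤ (length T) ρ≤cut) ⟩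
      N ℕ.+ (cutRow (suc t) ℕ.+ length T) ≤⟨ skew-hi t t<Z ⟩
      length P ℕ.+ (U t ℕ.+ length (Ṫ t)) ∎)
      where open ℕP.≤-Reasoning

    in-piece : ∀ {t e M} (pc : Piece t (cutRow (suc t)) e M) → t ℕ.< Z →
               ∀ v → InLayer t v × Band N v → InPiece pc v
    in-piece {t} pc t<Z (ρ , c) ((cut≤ρ , ρ≤cut) , band) =
      (cut≤ρ , subst (ρ ℕ.≤_) (sym (fragment-ends pc)) ρ≤cut) ,
      (col-lower t (ℕP.<⇒≤ t<Z) cut≤ρ band , col-upper t t<Z ρ≤cut band)

    in-trail : ∀ {e M} (pc : Piece Z (length P) e M) →
               ∀ v → cutRow Z ℕ.≤ row v × (Band N v × InGrid v) → InPiece pc v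
    in-trail pc (ρ , c) (cut≤ρ , band , ρ≤ , c≤) =
      (cut≤ρ , subst (ρ ℕ.≤_) (sym (fragment-ends pc)) ρ≤) ,
      (col-lower Z ℕP.≤-refl cut≤ρ band , ℕP.≤-trans c≤ (ℕP.≤-reflexive (GlueT.length-glue Z ℕP.≤-refl)))

    next-entry : ∀ t → t ℕ.< Z → ∀ {c′} → Band N (cutRow (suc t) , c′) →
                 Σ (Fin (suc Δ)) λ l′ → c′ ≡ U (suc t) ℕ.+ toℕ l′
    next-entry t t<Z {c′} band =
      fromℕ< (s≤s (ℕP.m≤n+o⇒m∸n≤o c′ (U (suc t)) c′≤)) ,
      sym (trans (cong (U (suc t) ℕ.+_) (FinP.toℕ-fromℕ< _)) (ℕP.m+[n∸m]≡n (col-lower (suc t) t<Z ℕP.≤-refl band)))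
      where
      c′≤ : c′ ℕ.≤ U (suc t) ℕ.+ Δ
      c′≤ = ℕP.≤-trans (col-upper t t<Z ℕP.≤-refl band) (ℕP.≤-reflexive (sym (GlueT.offset-suc t (ℕP.<⇒≤ t<Z))))

    first-layer : ∀ t → t ℕ.< Z → ∀ {L} → Piece t (cutRow (suc t)) (U (suc t)) L → ∀ l {c c′} → c ≡ U t ℕ.+ toℕ l →
                  (q : Path (cutRow t , c) (cutRow (suc t) , c′)) → All (InLayer t) q →
                  All (λ v → Band N v × InGrid v) q →
                  Σ (Fin (suc Δ)) λ l′ → c′ ≡ U (suc t) ℕ.+ toℕ l′ × L l l′ ℚ.≤ cost q
    first-layer t t<Z pc l c≡ q layer-q ok-q with next-entry t t<Z (proj₁ (All-last q ok-q))
    ... | l′ , c′≡ =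
      l′ , c′≡ ,
      piece-bound pc l l′ c≡ c′≡ q
        (All-map (λ v (lay , band , _) → in-piece pc t<Z v (lay , band)) q (All-zip q layer-q ok-q))

  module Chain (Dint : ℕ → Matrix Δ) (Dtrail : Matrix Δ)
    (int-piece-at : ∀ t → suc t ℕ.< Z → Piece (suc t) (cutRow (suc (suc t))) (U (suc (suc t))) (Dint (suc t)))
    (trail : Piece Z (length P) (length T ∸ Δ) Dtrail) where

    private
      last-index : ∀ {t} → t ℕ.+ 1 ≡ Z → t ≡ z′
      last-index {t} e = ℕP.suc-injective (trans (ℕP.+-comm 1 t) e)

      next-index : ∀ {t n} → t ℕ.+ suc (suc n) ≡ Z → suc t ℕ.+ suc n ≡ Z
      next-index {t} {n} e = trans (sym (ℕP.+-suc t (suc n))) e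

      join : ∀ {u v w a b} → Σ (Path u v) (λ q → cost q ≡ a) → Σ (Path v w) (λ q → cost q ≡ b) →
             Σ (Path u w) λ q → cost q ≡ a ℚ.+ b
      join (q₁ , c₁) (q₂ , c₂) = q₁ ++ₚ q₂ , trans (cost-++ q₁ q₂) (cong₂ ℚ._+_ c₁ c₂)

    chain-realised : ∀ n t → t ℕ.+ suc n ≡ Z → ∀ {L} → Piece t (cutRow (suc t)) (U (suc t)) L → ∀ l j →
                     Σ (Path (cutRow t , U t ℕ.+ toℕ l) (length P , target j)) λ q →
                       cost q ≡ chain L Dint (suc t) n Dtrail l j
    chain-realised zero t e {L} pc l j with last-index e
    ... | refl with ⊕-attained L Dtrail l j
    ...   | l′ , min≡ with join (piece-path pc l l′) (piece-path trail l′ j)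
    ...     | q , cost-q = q , trans cost-q (sym min≡)
    chain-realised (suc n) t e {L} pc l j with ⊕-attained L (chain (Dint (suc t)) Dint (suc (suc t)) n Dtrail) l j
    ... | l′ , min≡ with join (piece-path pc l l′)
                             (chain-realised n (suc t) (next-index e) (int-piece-at t (index<Z (next-index e))) l′ j)
    ...   | q , cost-q = q , trans cost-q (sym min≡)

    module _ (N : ℕ) (skew-lo : ∀ t → t ℕ.< Z → U (suc t) ℕ.+ N ℕ.≤ cutRow (suc t))
      (skew-hi : ∀ t → t ℕ.< Z → N ℕ.+ (cutRow (suc t) ℕ.+ length T) ℕ.≤ length P ℕ.+ (U t ℕ.+ length (Ṫ t))) where
      open Confined N skew-lo skew-hi

      chain-≤-layered : ∀ n t → t ℕ.+ suc n ≡ Z → ∀ {L} → Piece t (cutRow (suc t)) (U (suc t)) L →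
                        ∀ j l {c} → c ≡ U t ℕ.+ toℕ l → (ly : Layered (target j) (suc n) t c) →
                        All (λ v → Band N v × InGrid v) (flatten (suc n) ly) →
                        chain L Dint (suc t) n Dtrail l j ℚ.≤ cost (flatten (suc n) ly)
      chain-≤-layered zero t e {L} pc j l c≡ (c′ , q , layer-q , q′ , below) ok with last-index e
      ... | refl with first-layer t (index<Z e) pc l c≡ q layer-q (All-++⁻ˡ q q′ ok)
      ...   | l′ , c′≡ , L≤q = ℚP.≤-trans (⊕-≤ L Dtrail l l′ j L≤q trail≤q′) (ℚP.≤-reflexive (sym (cost-++ q q′)))
        where
        trail≤q′ : Dtrail l′ j ℚ.≤ cost q′
        trail≤q′ = piece-bound trail l′ j c′≡ refl q′
                     (All-map (in-trail trail) q′ (All-zip q′ below (All-++⁻ʳ q q′ ok)))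
      chain-≤-layered (suc n) t e {L} pc j l c≡ (c′ , q , layer-q , rest) ok
        with first-layer t (index<Z e) pc l c≡ q layer-q (All-++⁻ˡ q (flatten (suc n) rest) ok)
      ... | l′ , c′≡ , L≤q =
        ℚP.≤-trans (⊕-≤ L (chain (Dint (suc t)) Dint (suc (suc t)) n Dtrail) l l′ j L≤q
                     (chain-≤-layered n (suc t) (next-index e) (int-piece-at t (index<Z (next-index e)))
                                      j l′ c′≡ rest (All-++⁻ʳ q (flatten (suc n) rest) ok)))
                   (ℚP.≤-reflexive (sym (cost-++ q (flatten (suc n) rest))))

-- The two bounds

module Assembly {A : Set} (ω : NormalizedWeight A) (Δ z′ : ℕ) (Ṗ Ṫ : ℕ → List A)
  (Δ≤∣Ṗ∣ : ∀ s → s ℕ.≤ suc z′ → Δ ℕ.≤ length (Ṗ s))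
  (Δ≤∣Ṫ∣ : ∀ s → s ℕ.≤ suc z′ → Δ ℕ.≤ length (Ṫ s))
  (Ṗ-overlaps : ∀ s → s ℕ.< suc z′ → drop (length (Ṗ s) ∸ Δ) (Ṗ s) ≡ take Δ (Ṗ (suc s)))
  (Ṫ-overlaps : ∀ s → s ℕ.< suc z′ → drop (length (Ṫ s) ∸ Δ) (Ṫ s) ≡ take Δ (Ṫ (suc s))) where

  open Decomposition ω Δ z′ Ṗ Ṫ Δ≤∣Ṗ∣ Δ≤∣Ṫ∣ Ṗ-overlaps Ṫ-overlaps
  open AlignmentPaths ω P T

  τ : ℕ
  τ = sumTo (suc Z) (λ s → ∣ length (Ṫ s) - length (Ṗ s) ∣)

  offset-skew : ∀ {m n} → m ℕ.≤ n → n ℕ.≤ suc Z → U n ℕ.+ O m ℕ.≤ O n ℕ.+ U m ℕ.+ τ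
  offset-skew {m} {n} m≤n n≤ =
    ℕP.≤-trans (sumTo-skew _ _ _ m≤n termwise) (ℕP.+-monoʳ-≤ (O n ℕ.+ U m) (sumTo-mono _ n≤))
    where
    termwise : ∀ s → s ℕ.< n → length (Ṫ s) ∸ Δ ℕ.≤ (length (Ṗ s) ∸ Δ) ℕ.+ ∣ length (Ṫ s) - length (Ṗ s) ∣
    termwise s s<n = ℕP.≤-trans (ℕP.∸-monoˡ-≤ Δ (ℕP.m≤n+∣m-n∣ (length (Ṫ s)) (length (Ṗ s))))
                       (ℕP.≤-reflexive (ℕP.+-∸-comm _ (Δ≤∣Ṗ∣ s (ℕP.≤-pred (ℕP.<-≤-trans s<n n≤)))))

  skew-lo : ∀ N → τ ℕ.+ N ℕ.< half → ∀ t → t ℕ.< Z → U (suc t) ℕ.+ N ℕ.≤ cutRow (suc t)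
  skew-lo N τ+N<half t t<Z = begin
    U (suc t) ℕ.+ N             ≤⟨ ℕP.+-monoˡ-≤ N U≤O+τ ⟩
    O (suc t) ℕ.+ τ ℕ.+ N       ≡⟨ ℕP.+-assoc (O (suc t)) τ N ⟩
    O (suc t) ℕ.+ (τ ℕ.+ N)     ≤⟨ ℕP.+-monoʳ-≤ (O (suc t)) (ℕP.<⇒≤ τ+N<half) ⟩
    O (suc t) ℕ.+ half          ∎
    where
    open ℕP.≤-Reasoning
    U≤O+τ : U (suc t) ℕ.≤ O (suc t) ℕ.+ τ
    U≤O+τ = subst₂ ℕ._≤_ (ℕP.+-identityʳ (U (suc t))) (cong (ℕ._+ τ) (ℕP.+-identityʳ (O (suc t))))
              (offset-skew z≤n (s≤s (ℕP.<⇒≤ t<Z)))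

  skew-hi : ∀ N → τ ℕ.+ N ℕ.< half → ∀ t → t ℕ.< Z →
            N ℕ.+ (cutRow (suc t) ℕ.+ length T) ℕ.≤ length P ℕ.+ (U t ℕ.+ length (Ṫ t))
  skew-hi N τ+N<half t t<Z = begin
    N ℕ.+ (O (suc t) ℕ.+ half ℕ.+ length T)                  ≡⟨ cong (λ n → N ℕ.+ (O (suc t) ℕ.+ half ℕ.+ n)) ∣T∣≡ ⟩
    N ℕ.+ (O (suc t) ℕ.+ half ℕ.+ (U (suc Z) ℕ.+ Δ))         ≡⟨ regroup₁ N (O (suc t)) half (U (suc Z)) Δ ⟩
    U (suc Z) ℕ.+ O (suc t) ℕ.+ (Δ ℕ.+ (N ℕ.+ half))         ≤⟨ ℕP.+-monoˡ-≤ _ (offset-skew (s≤s (ℕP.<⇒≤ t<Z)) ℕP.≤-refl) ⟩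
    O (suc Z) ℕ.+ U (suc t) ℕ.+ τ ℕ.+ (Δ ℕ.+ (N ℕ.+ half))   ≡⟨ regroup₂ (O (suc Z)) (U (suc t)) τ Δ N half ⟩
    O (suc Z) ℕ.+ Δ ℕ.+ (U (suc t) ℕ.+ (τ ℕ.+ N ℕ.+ half))   ≤⟨ ℕP.+-monoʳ-≤ (O (suc Z) ℕ.+ Δ) (ℕP.+-monoʳ-≤ (U (suc t)) slack) ⟩
    O (suc Z) ℕ.+ Δ ℕ.+ (U (suc t) ℕ.+ Δ)                    ≡⟨ cong₂ ℕ._+_ (sym ∣P∣≡) (GlueT.offset-suc t (ℕP.<⇒≤ t<Z)) ⟩
    length P ℕ.+ (U t ℕ.+ length (Ṫ t))                       ∎
    where
    open ℕP.≤-Reasoning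
    ∣T∣≡ : length T ≡ U (suc Z) ℕ.+ Δ
    ∣T∣≡ = trans (GlueT.length-glue Z ℕP.≤-refl) (sym (GlueT.offset-suc Z ℕP.≤-refl))
    ∣P∣≡ : length P ≡ O (suc Z) ℕ.+ Δ
    ∣P∣≡ = trans (GlueP.length-glue Z ℕP.≤-refl) (sym (GlueP.offset-suc Z ℕP.≤-refl))
    slack : τ ℕ.+ N ℕ.+ half ℕ.≤ Δ
    slack = ℕP.≤-trans (ℕP.+-monoˡ-≤ half (ℕP.<⇒≤ τ+N<half)) (half+half≤ Δ)
    regroup₁ : ∀ n o h u d → n ℕ.+ (o ℕ.+ h ℕ.+ (u ℕ.+ d)) ≡ u ℕ.+ o ℕ.+ (d ℕ.+ (n ℕ.+ h))
    regroup₁ = solve-∀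
    regroup₂ : ∀ o u s d n h → o ℕ.+ u ℕ.+ s ℕ.+ (d ℕ.+ (n ℕ.+ h)) ≡ o ℕ.+ d ℕ.+ (u ℕ.+ (s ℕ.+ n ℕ.+ h))
    regroup₂ = solve-∀

  module Matrices (D Dlead Dtrail : Matrix Δ) (Dint : ℕ → Matrix Δ)
    (isD : IsD ω Δ P T D)
    (isD-lead : IsDlead ω Δ (Ṗ 0) (Ṫ 0) Dlead)
    (isD-int : ∀ s → 1 ℕ.≤ s → s ℕ.≤ z′ → IsDint ω Δ (Ṗ s) (Ṫ s) (Dint s))
    (isD-trail : IsDtrail ω Δ (Ṗ Z) (Ṫ Z) Dtrail) where

    open Chain Dint Dtrail
      (λ t t+1<Z → int-piece t (ℕP.<⇒≤ t+1<Z) (isD-int (suc t) (s≤s z≤n) (ℕP.≤-pred t+1<Z)))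
      (trail-piece isD-trail)

    private
      Δ≤∣T∣ : Δ ℕ.≤ length T
      Δ≤∣T∣ = ℕP.≤-trans (Δ≤∣Ṫ∣ 0 z≤n) (fits (text-occurs z≤n))

      start-inGrid : ∀ (i : Fin (suc Δ)) → InGrid (0 , toℕ i)
      start-inGrid i = z≤n , ℕP.≤-trans (FinP.toℕ≤pred[n] i) Δ≤∣T∣

      target≤∣T∣ : ∀ j → target j ℕ.≤ length T
      target≤∣T∣ j = ℕP.≤-trans (ℕP.+-monoʳ-≤ (length T ∸ Δ) (FinP.toℕ≤pred[n] j)) (ℕP.≤-reflexive (ℕP.m∸n+n≡m Δ≤∣T∣))

    D≤chain : ∀ i j → D i j ℚ.≤ chain Dlead Dint 1 z′ Dtrail i j
    D≤chain i j with chain-realised z′ 0 refl (lead-piece isD-lead) i j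
    ... | q , cost-q = ℚP.≤-trans (dist-minimal (isD i j) q) (ℚP.≤-reflexive cost-q)

    chain≤D : ∀ k → k ℤ.≤ + half ℤ.- + τ → ∀ i j → D i j ℚ.< ℤtoℚ k → chain Dlead Dint 1 z′ Dtrail i j ℚ.≤ D i j
    chain≤D k k≤ i j D<k with dist-realised (isD i j)
    ... | p , cost-p with layer (suc z′) 0 refl p (All-universal (λ _ → z≤n) p) (start-inGrid i)
    ... | ly , cost-ly =
      ℚP.≤-trans (chain-≤-layered N (skew-lo N τ+N<half) (skew-hi N τ+N<half) z′ 0 refl (lead-piece isD-lead) j i refl ly
                                  in-band)
                 (ℚP.≤-trans cost-ly (ℚP.≤-reflexive cost-p))
      where
      p′ : Path (0 , toℕ i) (length P , target j)
      p′ = flatten (suc z′) ly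
      N : ℕ
      N = indels p′
      τ+N<half : τ ℕ.+ N ℕ.< half
      τ+N<half = +N<k≤f-τ⇒τ+N<f (·1ℚ<ℤtoℚ⇒< N k
        (ℚP.≤-<-trans (indels≤cost p′) (ℚP.≤-<-trans cost-ly (ℚP.≤-<-trans (ℚP.≤-reflexive cost-p) D<k)))) k≤
      in-band : All (λ v → Band N v × InGrid v) p′
      in-band = All-map (λ _ ((from-start , to-end) , grid) →
                           (drift-from-left z≤n from-start , drift-to-right (target≤∣T∣ j) to-end) , grid)
                        p′ (All-zip p′ (drift-along p′) (path-inGrid (start-inGrid i) p′))

theorem5p25 : {A : Set} (ω : NormalizedWeight A) (Δ z : ℕ) (Ṗ Ṫ : ℕ → List A) →
    1 ℕ.≤ Δ → 2 ℕ.≤ z →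
    (∀ s → s ℕ.< z → Δ ℕ.≤ length (Ṗ s) × Δ ℕ.≤ length (Ṫ s)) →
    (∀ s → suc s ℕ.< z → drop (length (Ṗ s) ∸ Δ) (Ṗ s) ≡ take Δ (Ṗ (suc s))) →
    (∀ s → suc s ℕ.< z → drop (length (Ṫ s) ∸ Δ) (Ṫ s) ≡ take Δ (Ṫ (suc s))) →
    (k : ℤ) → k ℤ.≤ (+ (Δ ℕ./ 2)) ℤ.- (+ sumTo z (λ s → ∣ length (Ṫ s) - length (Ṗ s) ∣)) →
    (D Dlead Dtrail : Matrix Δ) (Dint : ℕ → Matrix Δ) →
    IsD ω Δ (glue Δ Ṗ (z ∸ 1)) (glue Δ Ṫ (z ∸ 1)) D →
    IsDlead ω Δ (Ṗ 0) (Ṫ 0) Dlead →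
    (∀ s → 1 ℕ.≤ s → s ℕ.≤ z ∸ 2 → IsDint ω Δ (Ṗ s) (Ṫ s) (Dint s)) →
    IsDtrail ω Δ (Ṗ (z ∸ 1)) (Ṫ (z ∸ 1)) Dtrail →
    D ≡M[ ℤtoℚ k ] chain Dlead Dint 1 (z ∸ 2) Dtrail
theorem5p25 ω Δ (suc (suc z′)) Ṗ Ṫ _ (s≤s (s≤s z≤n)) long Ṗ-overlaps Ṫ-overlaps k k≤
            D Dlead Dtrail Dint isD isD-lead isD-int isD-trail i j =
  ≡[]-intro (D≤chain i j) (chain≤D k k≤ i j)
  where
  open Assembly ω Δ z′ Ṗ Ṫ (λ s s≤Z → proj₁ (long s (s≤s s≤Z))) (λ s s≤Z → proj₂ (long s (s≤s s≤Z)))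
                            (λ s s<Z → Ṗ-overlaps s (s≤s s<Z)) (λ s s<Z → Ṫ-overlaps s (s≤s s<Z))
  open Matrices D Dlead Dtrail Dint isD isD-lead isD-int isD-trail
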